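{- Let $R=\{(0,0),(0,1),(0,2),(1,0),(1,1),(1,2),(2,0),(2,1),(2,2)\}$. Then $(123,R)\sim_d(132,R)$.
   Context: $S_n$ denotes the set of permutations of $[n]=\{1,\dots,n\}$, written $\pi=\pi_1\cdots\pi_n$. A mesh pattern of length $k$ is a pair $(\tau,R)$ with $\tau\in S_k$ and $R\subseteq\{0,1,\dots,k\}^2$ (the shaded boxes; box $(a,b)$ is the unit square $[a,a+1]\times[b,b+1]$ in the diagram of $\tau$). An occurrence of $(\tau,R)$ in $\pi\in S_n$ is a choice of indices $i_1<\dots<i_k$ such that $\pi_{i_1}\cdots\pi_{i_k}$ is order-isomorphic to $\tau$ and, with $i_0=0$, $i_{k+1}=n+1$, $v_1<\dots<v_k$ the values $\pi_{i_1},\dots,\pi_{i_k}$ sorted increasingly, $v_0=0$, $v_{k+1}=n+1$, for every $(a,b)\in R$ there is no index $m$ with $i_a<m<i_{a+1}$ and $v_b<\pi_m<v_{b+1}$. Mesh patterns $p,q$ are equidistributed, $p\sim_d q$, if for all $n,\ell\ge0$ the number of $\pi\in S_n$ with exactly $\ell$ occurrences of $p$ equals the number with exactly $\ell$ occurrences of $q$. -}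

module Defs where

open import Data.Bool using (Bool; true; false; _∧_; _∨_; not; if_then_else_)
open import Data.Nat using (ℕ; zero; suc; _+_; _<ᵇ_; _≡ᵇ_)
open import Data.List using (List; []; _∷_; _++_; map; filter; length; concatMap)
open import Data.Bool.ListAction using (all; any)
open import Data.Bool using (_≟_)
import Data.Nat as N
open import Relation.Binary.PropositionalEquality using (_≡_)
open import Data.Product using (_×_; _,_)

-- Permutations are words π₁⋯πₙ, represented as lists of naturals.
-- [a .. b] as an increasing list (empty if b < a); here: range a len = a, a+1, ..., a+len-1
range : ℕ → ℕ → List ℕ
range a zero    = []
range a (suc l) = a ∷ range (suc a) l

[_] : ℕ → List ℕ
[ n ] = range 1 n

-- 1-based access with default 0 ; 0-based access with default 0
at₀ : List ℕ → ℕ → ℕ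
at₀ []       _       = 0
at₀ (x ∷ xs) zero    = x
at₀ (x ∷ xs) (suc m) = at₀ xs m

at : List ℕ → ℕ → ℕ
at π zero    = 0
at π (suc m) = at₀ π m

words : List ℕ → ℕ → List (List ℕ)
words A zero    = [] ∷ []
words A (suc k) = concatMap (λ x → map (x ∷_) (words A k)) A

elem : ℕ → List ℕ → Bool
elem x = any (λ y → x ≡ᵇ y)

distinct : List ℕ → Bool
distinct []       = true
distinct (x ∷ xs) = not (elem x xs) ∧ distinct xs

S : ℕ → List (List ℕ)
S n = filter (λ w → _≟_ (distinct w) true) (words [ n ] n)

insert : ℕ → List ℕ → List ℕ
insert x []       = x ∷ []
insert x (y ∷ ys) = if x <ᵇ y then x ∷ y ∷ ys else y ∷ insert x ys

sort : List ℕ → List ℕ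
sort []       = []
sort (x ∷ xs) = insert x (sort xs)

choose : ℕ → List ℕ → List (List ℕ)
choose zero    xs       = [] ∷ []
choose (suc k) []       = []
choose (suc k) (x ∷ xs) = map (x ∷_) (choose k xs) ++ choose (suc k) xs

-- A mesh pattern: τ given as a word over [k], and a list of shaded boxes (a , b)
record MeshPattern : Set where
  constructor mesh
  field
    τ   : List ℕ
    Rsh : List (ℕ × ℕ)
open MeshPattern public

eqB : Bool → Bool → Bool
eqB true  y = y
eqB false y = not y

orderIso : List ℕ → List ℕ → Bool
orderIso u τ =
  (length u ≡ᵇ length τ) ∧
  all (λ a → all (λ b → eqB (at u a <ᵇ at u b) (at τ a <ᵇ at τ b))
                   [ length τ ]) [ length τ ]

isOcc : MeshPattern → List ℕ → List ℕ → Bool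
isOcc p π is =
  orderIso vals (τ p) ∧ all boxOK (Rsh p)
  where
    n    = length π
    vals = map (at π) is
    I    = 0 ∷ is ++ (suc n ∷ [])             -- i₀ = 0, i_{k+1} = n+1 (0-based: I ! a = i_a)
    V    = 0 ∷ sort vals ++ (suc n ∷ [])      -- v₀ = 0, sorted values, v_{k+1} = n+1
    boxOK : ℕ × ℕ → Bool
    boxOK (a , b) =
      not (any (λ m → (at₀ I a <ᵇ m) ∧ (m <ᵇ at₀ I (suc a))
                    ∧ (at₀ V b <ᵇ at π m) ∧ (at π m <ᵇ at₀ V (suc b)))
               [ n ])

occ : MeshPattern → List ℕ → ℕ
occ p π = length (filter (λ is → _≟_ (isOcc p π is) true)
                         (choose (length (τ p)) [ length π ]))

count : MeshPattern → ℕ → ℕ → ℕ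
count p n ℓ = length (filter (λ π → N._≟_ (occ p π) ℓ) (S n))

_∼d_ : MeshPattern → MeshPattern → Set
p ∼d q = ∀ (n ℓ : ℕ) → count p n ℓ ≡ count q n ℓ

R₃ : List (ℕ × ℕ)
R₃ = (0 , 0) ∷ (0 , 1) ∷ (0 , 2) ∷ (1 , 0) ∷ (1 , 1) ∷ (1 , 2) ∷ (2 , 0) ∷ (2 , 1) ∷ (2 , 2) ∷ []

{-# OPTIONS --safe #-}
module Submission where

-- Appending an entry c to a permutation σ of [n], after shifting up the entries ≥ c, builds every
-- permutation of [n + 1] exactly once, so permutations are coded by the sequences of their last
-- entries. For the shading R₃ = {0,1,2}², a triple i₁ < i₂ < i₃ is an occurrence iff its entries
-- form the pattern and no other entry left of i₃ lies below the largest of them. Appending c keeps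
-- the old occurrences and adds one ending at the new entry exactly when 1 precedes 2 in σ and
-- c = 3 (for 123) resp. c = 2 (for 132): the values below the threshold must be the other two
-- pattern entries, hence 1 and 2. Both statistics are thus sums of one indicator along the code,
-- evaluated at 3 resp. 2, and exchanging 2 and 3 in the code wherever 1 precedes 2 in the prefix
-- built so far is an involution on codes carrying one statistic to the other; the exchange does
-- not change whether 1 precedes 2 in the later prefixes.

open import Defs

open import Algebra.Properties.CommutativeSemigroup using (interchange; x∙yz≈y∙xz)
open import Data.Bool using (Bool; true; false; _∧_; not; if_then_else_; T)
import Data.Bool as Bool
open import Data.Bool.ListAction using (all; any)
open import Data.Bool.Properties using (T-∧; T-≡; ∧-zeroʳ; ∧-identityʳ)
open import Data.Empty using (⊥; ⊥-elim)
open import Data.List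
  using (List; []; _∷_; _++_; _∷ʳ_; map; filter; length; concatMap; cartesianProductWith; initLast; _∷ʳ′_)
open import Data.List.Membership.Propositional using (_∈_; _∉_; find)
open import Data.List.Membership.Propositional.Properties
  using (∈-map⁺; ∈-map⁻; ∈-++⁺ˡ; ∈-++⁺ʳ; ∈-filter⁺; ∈-filter⁻; ∈-cartesianProductWith⁺; ∈-cartesianProductWith⁻)
open import Data.List.Membership.Propositional.Properties.WithK using (unique∧set⇒bag)
open import Data.List.Properties
  using (length-map; length-++; map-∘; map-++; map-cong-local; map-id; ∷-injective; ∷ʳ-injective; map-injective)
open import Data.List.Relation.Binary.BagAndSetEquality using (∼bag⇒↭)
open import Data.List.Relation.Binary.Permutation.Propositional as ↭ using (_↭_)
open import Data.List.Relation.Unary.All as All using (All; []; _∷_)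
open import Data.List.Relation.Unary.All.Properties using (all⁺; all⁻; ¬Any⇒All¬; All¬⇒¬Any; ++⁺; map⁺; ∷ʳ⁺; ∷ʳ⁻)
open import Data.List.Relation.Unary.Any as Any using (here; there)
open import Data.List.Relation.Unary.Any.Properties using (any⁺; any⁻)
open import Data.List.Relation.Unary.Unique.Propositional using (Unique; []; _∷_)
import Data.List.Relation.Unary.Unique.Propositional.Properties as Unique
open import Data.Nat using (ℕ; zero; suc; _+_; _<ᵇ_; _≡ᵇ_; _≤_; _<_; z≤n; s≤s; z<s; pred)
import Data.Nat as ℕ
open import Data.Nat.Properties
open import Data.Product using (_×_; _,_; proj₁; proj₂; ∃-syntax)
open import Data.Sum using (_⊎_; inj₁; inj₂)
open import Data.Unit using (⊤)
open import Function using (_∘_; _⇔_; mk⇔; Equivalence)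
open import Function.Construct.Composition using (_⇔-∘_)
open import Function.Construct.Symmetry using (⇔-sym)
open import Relation.Binary using (tri<; tri≈; tri>)
open import Relation.Binary.PropositionalEquality hiding ([_])
open import Relation.Nullary using (¬_; contradiction; yes; no; does)
open import Relation.Unary using (Decidable)

T⇒≡true : ∀ {b} → T b → b ≡ true
T⇒≡true = Equivalence.to T-≡

¬T⇒≡false : ∀ {b} → ¬ T b → b ≡ false
¬T⇒≡false {false} _  = refl
¬T⇒≡false {true}  ¬t = contradiction _ ¬t

T-not : ∀ {b} → T (not b) ⇔ (¬ T b)
T-not {false} = mk⇔ (λ _ ()) _
T-not {true}  = mk⇔ (λ ()) (λ ¬t → ¬t _)

T-⇔→≡ : ∀ {x y} → T x ⇔ T y → x ≡ y
T-⇔→≡ {true}  {true}  _ = refl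
T-⇔→≡ {true}  {false} h = ⊥-elim (Equivalence.to h _)
T-⇔→≡ {false} {true}  h = ⊥-elim (Equivalence.from h _)
T-⇔→≡ {false} {false} _ = refl

T-≡ᵇ³ : ∀ {a a′ b b′ d d′} → T ((a ≡ᵇ a′) ∧ (b ≡ᵇ b′) ∧ (d ≡ᵇ d′)) ⇔ (a ≡ a′ × b ≡ b′ × d ≡ d′)
T-≡ᵇ³ {a} {a′} {b} {b′} {d} {d′} = mk⇔
  (λ t → let ta , tbd = Equivalence.to (T-∧ {a ≡ᵇ a′}) t ; tb , td = Equivalence.to (T-∧ {b ≡ᵇ b′}) tbd
         in ≡ᵇ⇒≡ _ _ ta , ≡ᵇ⇒≡ _ _ tb , ≡ᵇ⇒≡ _ _ td)
  (λ (e₁ , e₂ , e₃) → Equivalence.from T-∧ (≡⇒≡ᵇ _ _ e₁ , Equivalence.from T-∧ (≡⇒≡ᵇ _ _ e₂ , ≡⇒≡ᵇ _ _ e₃)))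

<ᵇ-true : ∀ {m n} → m < n → (m <ᵇ n) ≡ true
<ᵇ-true = T⇒≡true ∘ <⇒<ᵇ

<ᵇ-false : ∀ {m n} → n ≤ m → (m <ᵇ n) ≡ false
<ᵇ-false n≤m = ¬T⇒≡false (≤⇒≯ n≤m ∘ <ᵇ⇒< _ _)

<ᵇ-irrefl : ∀ n → (n <ᵇ n) ≡ false
<ᵇ-irrefl n = <ᵇ-false (≤-refl {n})

≡ᵇ-true : ∀ {m n} → m ≡ n → (m ≡ᵇ n) ≡ true
≡ᵇ-true {m} {n} = T⇒≡true ∘ ≡⇒≡ᵇ m n

≡ᵇ-false : ∀ {m n} → m ≢ n → (m ≡ᵇ n) ≡ false
≡ᵇ-false m≢n = ¬T⇒≡false (m≢n ∘ ≡ᵇ⇒≡ _ _)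

does-≟-true : ∀ b → does (b Bool.≟ true) ≡ b
does-≟-true false = refl
does-≟-true true  = refl

toℕ : Bool → ℕ
toℕ false = 0
toℕ true  = 1

countᵇ : {A : Set} → (A → Bool) → List A → ℕ
countᵇ p []       = 0
countᵇ p (x ∷ xs) = toℕ (p x) + countᵇ p xs

module _ {A : Set} where

  length-filter : ∀ {P : A → Set} (P? : Decidable P) xs → length (filter P? xs) ≡ countᵇ (does ∘ P?) xs
  length-filter P? []       = refl
  length-filter P? (x ∷ xs) with does (P? x)
  ... | true  = cong suc (length-filter P? xs)
  ... | false = length-filter P? xs

  countᵇ-++ : ∀ (p : A → Bool) xs ys → countᵇ p (xs ++ ys) ≡ countᵇ p xs + countᵇ p ys
  countᵇ-++ p []       ys = refl
  countᵇ-++ p (x ∷ xs) ys = trans (cong (toℕ (p x) +_) (countᵇ-++ p xs ys)) (sym (+-assoc (toℕ (p x)) _ _))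

  countᵇ-map : ∀ {B : Set} (p : B → Bool) (f : A → B) xs → countᵇ p (map f xs) ≡ countᵇ (p ∘ f) xs
  countᵇ-map p f []       = refl
  countᵇ-map p f (x ∷ xs) = cong (toℕ (p (f x)) +_) (countᵇ-map p f xs)

  countᵇ-cong : ∀ {P : A → Set} {p q : A → Bool} {xs} → All P xs → (∀ {x} → P x → p x ≡ q x) →
                countᵇ p xs ≡ countᵇ q xs
  countᵇ-cong []         p≗q = refl
  countᵇ-cong (px ∷ pxs) p≗q = cong₂ _+_ (cong toℕ (p≗q px)) (countᵇ-cong pxs p≗q)

  countᵇ-≗ : ∀ {p q : A → Bool} → (∀ x → p x ≡ q x) → ∀ xs → countᵇ p xs ≡ countᵇ q xs
  countᵇ-≗ p≗q []       = refl
  countᵇ-≗ p≗q (x ∷ xs) = cong₂ _+_ (cong toℕ (p≗q x)) (countᵇ-≗ p≗q xs)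

  countᵇ-false : ∀ (xs : List A) → countᵇ (λ _ → false) xs ≡ 0
  countᵇ-false []       = refl
  countᵇ-false (x ∷ xs) = countᵇ-false xs

  countᵇ-↭ : ∀ (p : A → Bool) {xs ys} → xs ↭ ys → countᵇ p xs ≡ countᵇ p ys
  countᵇ-↭ p ↭.refl            = refl
  countᵇ-↭ p (↭.prep x xs↭ys)   = cong (toℕ (p x) +_) (countᵇ-↭ p xs↭ys)
  countᵇ-↭ p (↭.swap x y xs↭ys) =
    trans (x∙yz≈y∙xz +-commutativeSemigroup (toℕ (p x)) (toℕ (p y)) _)
          (cong (λ k → toℕ (p y) + (toℕ (p x) + k)) (countᵇ-↭ p xs↭ys))
  countᵇ-↭ p (↭.trans xs↭ys ys↭zs) = trans (countᵇ-↭ p xs↭ys) (countᵇ-↭ p ys↭zs)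

  countᵇ-∧ˡ : ∀ b (p : A → Bool) xs → countᵇ (λ x → b ∧ p x) xs ≡ (if b then countᵇ p xs else 0)
  countᵇ-∧ˡ true  p xs = refl
  countᵇ-∧ˡ false p xs = countᵇ-false xs

Unique-⊆⊇⇒↭ : ∀ {A : Set} {xs ys : List A} → Unique xs → Unique ys →
              (∀ {z} → z ∈ xs → z ∈ ys) → (∀ {z} → z ∈ ys → z ∈ xs) → xs ↭ ys
Unique-⊆⊇⇒↭ xs! ys! xs⊆ys ys⊆xs = ∼bag⇒↭ (unique∧set⇒bag xs! ys! (mk⇔ xs⊆ys ys⊆xs))

countᵇ-≡ᵇ-∉ : ∀ {v} {xs : List ℕ} → v ∉ xs → countᵇ (_≡ᵇ v) xs ≡ 0
countᵇ-≡ᵇ-∉ {v} {[]}     v∉ = refl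
countᵇ-≡ᵇ-∉ {v} {x ∷ xs} v∉
  rewrite ≡ᵇ-false {x} {v} (λ x≡v → v∉ (here (sym x≡v))) = countᵇ-≡ᵇ-∉ (v∉ ∘ there)

countᵇ-≡ᵇ-unique : ∀ {v} {xs : List ℕ} → Unique xs → v ∈ xs → countᵇ (_≡ᵇ v) xs ≡ 1
countᵇ-≡ᵇ-unique {v} (x∉xs ∷ _) (here refl)
  rewrite ≡ᵇ-true {v} refl = cong suc (countᵇ-≡ᵇ-∉ (λ v∈ → All.lookup x∉xs v∈ refl))
countᵇ-≡ᵇ-unique {v} {x ∷ xs} (x∉xs ∷ u) (there v∈)
  rewrite ≡ᵇ-false {x} {v} (λ x≡v → All.lookup x∉xs v∈ x≡v) = countᵇ-≡ᵇ-unique u v∈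

∈-range⁻ : ∀ {v} a l → v ∈ range a l → a ≤ v × v < a + l
∈-range⁻ a (suc l) (here refl) = ≤-refl , m<m+n a z<s
∈-range⁻ {v} a (suc l) (there v∈) with a<v , v<a+1+l ← ∈-range⁻ (suc a) l v∈ =
  <⇒≤ a<v , subst (v <_) (sym (+-suc a l)) v<a+1+l

∈-range⁺ : ∀ {v} a l → a ≤ v → v < a + l → v ∈ range a l
∈-range⁺ {v} a zero    a≤v v<a+0 = contradiction (subst (v <_) (+-identityʳ a) v<a+0) (≤⇒≯ a≤v)
∈-range⁺ {v} a (suc l) a≤v v<a+l with v ≟ a
... | yes refl = here refl
... | no v≢a   = there (∈-range⁺ (suc a) l (≤∧≢⇒< a≤v (v≢a ∘ sym)) (subst (v <_) (+-suc a l) v<a+l))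

range-unique : ∀ a l → Unique (range a l)
range-unique a zero    = []
range-unique a (suc l) =
  All.tabulate (λ v∈ → <⇒≢ (proj₁ (∈-range⁻ (suc a) l v∈))) ∷ range-unique (suc a) l

range-∷ʳ : ∀ a l → range a (suc l) ≡ range a l ∷ʳ (a + l)
range-∷ʳ a zero    = cong (_∷ []) (sym (+-identityʳ a))
range-∷ʳ a (suc l) = cong (a ∷_) (trans (range-∷ʳ (suc a) l) (cong (range (suc a) l ∷ʳ_) (sym (+-suc a l))))

range-suc : ∀ a l → range (suc a) l ≡ map suc (range a l)
range-suc a zero    = refl
range-suc a (suc l) = cong (suc a ∷_) (range-suc (suc a) l)

Ascending : ℕ → ℕ → ℕ → List ℕ → Set
Ascending zero    lo hi []       = ⊤
Ascending zero    lo hi (_ ∷ _)  = ⊥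
Ascending (suc k) lo hi []       = ⊥
Ascending (suc k) lo hi (x ∷ xs) = lo ≤ x × x < hi × Ascending k (suc x) hi xs

Ascending-weaken : ∀ k {lo lo′ hi} xs → lo ≤ lo′ → Ascending k lo′ hi xs → Ascending k lo hi xs
Ascending-weaken zero    []       _     _                = _
Ascending-weaken (suc k) (x ∷ xs) lo≤lo′ (lo′≤x , x<hi , asc) = ≤-trans lo≤lo′ lo′≤x , x<hi , asc

choose-ascending : ∀ k a l → All (Ascending k a (a + l)) (choose k (range a l))
choose-ascending zero    a l       = _ ∷ []
choose-ascending (suc k) a zero    = []
choose-ascending (suc k) a (suc l) rewrite +-suc a l =
  ++⁺ (map⁺ (All.map (λ asc → ≤-refl , s≤s (m≤m+n a l) , asc) (choose-ascending k (suc a) l)))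
      (All.map (Ascending-weaken (suc k) _ (n≤1+n a)) (choose-ascending (suc k) (suc a) l))

choose-map : ∀ (f : ℕ → ℕ) k xs → choose k (map f xs) ≡ map (map f) (choose k xs)
choose-map f zero    xs       = refl
choose-map f (suc k) []       = refl
choose-map f (suc k) (x ∷ xs) = begin
  map (f x ∷_) (choose k (map f xs)) ++ choose (suc k) (map f xs)
    ≡⟨ cong₂ (λ ys zs → map (f x ∷_) ys ++ zs) (choose-map f k xs) (choose-map f (suc k) xs) ⟩
  map (f x ∷_) (map (map f) (choose k xs)) ++ map (map f) (choose (suc k) xs)
    ≡⟨ cong (_++ _) (trans (sym (map-∘ (choose k xs))) (map-∘ (choose k xs))) ⟩
  map (map f) (map (x ∷_) (choose k xs)) ++ map (map f) (choose (suc k) xs)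
    ≡⟨ map-++ (map f) (map (x ∷_) (choose k xs)) _ ⟨
  map (map f) (map (x ∷_) (choose k xs) ++ choose (suc k) xs) ∎
  where open ≡-Reasoning

countᵇ-choose-1 : ∀ (p : List ℕ → Bool) xs → countᵇ p (choose 1 xs) ≡ countᵇ (λ x → p (x ∷ [])) xs
countᵇ-choose-1 p []       = refl
countᵇ-choose-1 p (x ∷ xs) = cong (toℕ (p (x ∷ [])) +_) (countᵇ-choose-1 p xs)

countᵇ-choose-∷ : ∀ (p : List ℕ → Bool) k x xs →
  countᵇ p (choose (suc k) (x ∷ xs)) ≡ countᵇ (p ∘ (x ∷_)) (choose k xs) + countᵇ p (choose (suc k) xs)
countᵇ-choose-∷ p k x xs =
  trans (countᵇ-++ p (map (x ∷_) (choose k xs)) _) (cong (_+ _) (countᵇ-map p (x ∷_) (choose k xs)))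

countᵇ-choose-∷ʳ : ∀ (p : List ℕ → Bool) k xs z →
  countᵇ p (choose (suc k) (xs ∷ʳ z)) ≡ countᵇ p (choose (suc k) xs) + countᵇ (p ∘ (_∷ʳ z)) (choose k xs)
countᵇ-choose-∷ʳ p zero    []       z = refl
countᵇ-choose-∷ʳ p (suc k) []       z = refl
countᵇ-choose-∷ʳ p zero    (x ∷ xs) z = begin
  countᵇ p (choose 1 (x ∷ xs ∷ʳ z))
    ≡⟨ countᵇ-choose-∷ p zero x (xs ∷ʳ z) ⟩
  A + countᵇ p (choose 1 (xs ∷ʳ z))
    ≡⟨ cong (A +_) (countᵇ-choose-∷ʳ p zero xs z) ⟩
  A + (B + Bz)
    ≡⟨ +-assoc A B Bz ⟨
  A + B + Bz
    ≡⟨ cong (_+ Bz) (countᵇ-choose-∷ p zero x xs) ⟨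
  countᵇ p (choose 1 (x ∷ xs)) + Bz ∎
  where
  open ≡-Reasoning
  A B Bz : ℕ
  A  = countᵇ (p ∘ (x ∷_)) (choose 0 xs)
  B  = countᵇ p (choose 1 xs)
  Bz = countᵇ (p ∘ (_∷ʳ z)) (choose 0 xs)
countᵇ-choose-∷ʳ p (suc k) (x ∷ xs) z = begin
  countᵇ p (choose (suc (suc k)) (x ∷ xs ∷ʳ z))
    ≡⟨ countᵇ-choose-∷ p (suc k) x (xs ∷ʳ z) ⟩
  countᵇ (p ∘ (x ∷_)) (choose (suc k) (xs ∷ʳ z)) + countᵇ p (choose (suc (suc k)) (xs ∷ʳ z))
    ≡⟨ cong₂ _+_ (countᵇ-choose-∷ʳ (p ∘ (x ∷_)) k xs z) (countᵇ-choose-∷ʳ p (suc k) xs z) ⟩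
  (A + Az) + (B + Bz)
    ≡⟨ interchange +-commutativeSemigroup A Az B Bz ⟩
  (A + B) + (Az + Bz)
    ≡⟨ cong₂ _+_ (countᵇ-choose-∷ p (suc k) x xs) (countᵇ-choose-∷ (p ∘ (_∷ʳ z)) k x xs) ⟨
  countᵇ p (choose (suc (suc k)) (x ∷ xs)) + countᵇ (p ∘ (_∷ʳ z)) (choose (suc k) (x ∷ xs)) ∎
  where
  open ≡-Reasoning
  A Az B Bz : ℕ
  A  = countᵇ (p ∘ (x ∷_)) (choose (suc k) xs)
  Az = countᵇ (p ∘ (x ∷_) ∘ (_∷ʳ z)) (choose k xs)
  B  = countᵇ p (choose (suc (suc k)) xs)
  Bz = countᵇ (p ∘ (_∷ʳ z)) (choose (suc k) xs)

InRange : ℕ → ℕ → Set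
InRange n v = 1 ≤ v × v ≤ n

map-at₀-range : ∀ xs → map (at₀ xs) (range 0 (length xs)) ≡ xs
map-at₀-range []       = refl
map-at₀-range (x ∷ xs) = cong (x ∷_) (begin
  map (at₀ (x ∷ xs)) (range 1 (length xs))       ≡⟨ cong (map (at₀ (x ∷ xs))) (range-suc 0 (length xs)) ⟩
  map (at₀ (x ∷ xs)) (map suc (range 0 (length xs))) ≡⟨ map-∘ (range 0 (length xs)) ⟨
  map (at₀ xs) (range 0 (length xs))             ≡⟨ map-at₀-range xs ⟩
  xs                                             ∎)
  where open ≡-Reasoning

map-at-[] : ∀ xs → map (at xs) [ length xs ] ≡ xs
map-at-[] xs = trans (cong (map (at xs)) (range-suc 0 (length xs)))
                     (trans (sym (map-∘ (range 0 (length xs)))) (map-at₀-range xs))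

at-∈ : ∀ xs {m} → InRange (length xs) m → at xs m ∈ xs
at-∈ (x ∷ xs) {suc zero}    _            = here refl
at-∈ (x ∷ xs) {suc (suc i)} (_ , s≤s i<) = there (at-∈ xs (s≤s z≤n , i<))

∈⇒at : ∀ {v} {xs : List ℕ} → v ∈ xs → ∃[ m ] InRange (length xs) m × at xs m ≡ v
∈⇒at (here refl) = 1 , (≤-refl , s≤s z≤n) , refl
∈⇒at {xs = x ∷ xs} (there v∈) with suc i , (_ , m≤) , eq ← ∈⇒at v∈ = suc (suc i) , (s≤s z≤n , s≤s m≤) , eq

at-injective : ∀ {xs : List ℕ} → Unique xs → ∀ {i j} → InRange (length xs) i → InRange (length xs) j →
               at xs i ≡ at xs j → i ≡ j
at-injective {x ∷ xs} (x∉ ∷ u) {suc zero}    {suc zero}    _ _ eq = refl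
at-injective {x ∷ xs} (x∉ ∷ u) {suc zero}    {suc (suc j)} _ (_ , s≤s j<) eq =
  contradiction eq (All.lookup x∉ (at-∈ xs (s≤s z≤n , j<)))
at-injective {x ∷ xs} (x∉ ∷ u) {suc (suc i)} {suc zero}    (_ , s≤s i<) _ eq =
  contradiction (sym eq) (All.lookup x∉ (at-∈ xs (s≤s z≤n , i<)))
at-injective {x ∷ xs} (x∉ ∷ u) {suc (suc i)} {suc (suc j)} (_ , s≤s i<) (_ , s≤s j<) eq =
  cong suc (at-injective u (s≤s z≤n , i<) (s≤s z≤n , j<) eq)

at-map : ∀ (f : ℕ → ℕ) xs {m} → InRange (length xs) m → at (map f xs) m ≡ f (at xs m)
at-map f (x ∷ xs) {suc zero}    _            = refl
at-map f (x ∷ xs) {suc (suc i)} (_ , s≤s i<) = at-map f xs (s≤s z≤n , i<)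

at-++ˡ : ∀ xs ys {m} → InRange (length xs) m → at (xs ++ ys) m ≡ at xs m
at-++ˡ (x ∷ xs) ys {suc zero}    _            = refl
at-++ˡ (x ∷ xs) ys {suc (suc i)} (_ , s≤s i<) = at-++ˡ xs ys (s≤s z≤n , i<)

at-∷ʳ-last : ∀ xs c → at (xs ∷ʳ c) (suc (length xs)) ≡ c
at-∷ʳ-last []       c = refl
at-∷ʳ-last (x ∷ xs) c = at-∷ʳ-last xs c

-- Inserting a value into a permutation

punchIn : ℕ → ℕ → ℕ
punchIn c v = if v <ᵇ c then v else suc v

punchOut : ℕ → ℕ → ℕ
punchOut c v = if c <ᵇ v then pred v else v

punchIn-< : ∀ {c v} → v < c → punchIn c v ≡ v
punchIn-< v<c rewrite <ᵇ-true v<c = refl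

punchIn-≥ : ∀ {c v} → c ≤ v → punchIn c v ≡ suc v
punchIn-≥ c≤v rewrite <ᵇ-false c≤v = refl

punchIn-cases : ∀ c v → (v < c × punchIn c v ≡ v) ⊎ (c ≤ v × punchIn c v ≡ suc v)
punchIn-cases c v with v <? c
... | yes v<c = inj₁ (v<c , punchIn-< v<c)
... | no  v≮c = inj₂ (≮⇒≥ v≮c , punchIn-≥ (≮⇒≥ v≮c))

punchIn-mono-< : ∀ c {u v} → u < v → punchIn c u < punchIn c v
punchIn-mono-< c {u} {v} u<v with punchIn-cases c u | punchIn-cases c v
... | inj₁ (_ , eu)   | inj₁ (_ , ev)   rewrite eu | ev = u<v
... | inj₁ (_ , eu)   | inj₂ (_ , ev)   rewrite eu | ev = m<n⇒m<1+n u<v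
... | inj₂ (c≤u , _)  | inj₁ (v<c , _)  = contradiction (<-trans u<v v<c) (≤⇒≯ c≤u)
... | inj₂ (_ , eu)   | inj₂ (_ , ev)   rewrite eu | ev = s≤s u<v

punchIn-cancel-< : ∀ c {u v} → punchIn c u < punchIn c v → u < v
punchIn-cancel-< c {u} {v} lt with <-cmp u v
... | tri< u<v _ _ = u<v
... | tri≈ _ refl _ = contradiction lt (<-irrefl refl)
... | tri> _ _ v<u = contradiction (punchIn-mono-< c v<u) (<-asym lt)

punchIn-injective : ∀ c {u v} → punchIn c u ≡ punchIn c v → u ≡ v
punchIn-injective c {u} {v} eq with <-cmp u v
... | tri< u<v _ _ = contradiction eq (<⇒≢ (punchIn-mono-< c u<v))
... | tri≈ _ u≡v _ = u≡v
... | tri> _ _ v<u = contradiction (sym eq) (<⇒≢ (punchIn-mono-< c v<u))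

punchIn-≢ : ∀ c v → punchIn c v ≢ c
punchIn-≢ c v with punchIn-cases c v
... | inj₁ (v<c , e) = λ eq → <⇒≢ v<c (trans (sym e) eq)
... | inj₂ (c≤v , e) = λ eq → <⇒≢ (s≤s c≤v) (sym (trans (sym e) eq))

punchIn-punchOut : ∀ {c v} → v ≢ c → punchIn c (punchOut c v) ≡ v
punchIn-punchOut {zero}  {zero}  v≢c = contradiction refl v≢c
punchIn-punchOut {suc c} {zero}  _   = refl
punchIn-punchOut {c}     {suc w} v≢c with <-cmp c (suc w)
... | tri< c<v _ _ rewrite <ᵇ-true c<v = punchIn-≥ (≤-pred c<v)
... | tri≈ _ c≡v _ = contradiction (sym c≡v) v≢c
... | tri> _ _ v<c rewrite <ᵇ-false (<⇒≤ v<c) = punchIn-< v<c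

punchIn-≡ᵇ : ∀ {k c} → k < c → ∀ x → (punchIn c x ≡ᵇ k) ≡ (x ≡ᵇ k)
punchIn-≡ᵇ {k} {c} k<c x with punchIn-cases c x
... | inj₁ (_ , e)   rewrite e = refl
... | inj₂ (c≤x , e) rewrite e | ≡ᵇ-false {suc x} {k} (>⇒≢ (<-trans (<-≤-trans k<c c≤x) (n<1+n x)))
                             | ≡ᵇ-false {x} {k} (>⇒≢ (<-≤-trans k<c c≤x)) = refl

punchIn<⇒< : ∀ {c v} → punchIn c v < c → v < c
punchIn<⇒< {c} {v} lt with punchIn-cases c v
... | inj₁ (v<c , _) = v<c
... | inj₂ (c≤v , e) = contradiction (subst (_< c) e lt) (≤⇒≯ (m≤n⇒m≤1+n c≤v))

<punchIn⇒≤ : ∀ {c v} → c < punchIn c v → c ≤ v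
<punchIn⇒≤ {c} {v} lt with punchIn-cases c v
... | inj₁ (v<c , e) = contradiction (subst (c <_) e lt) (<-asym v<c)
... | inj₂ (c≤v , _) = c≤v

punchIn-InRange : ∀ {n} c {v} → InRange n v → InRange (suc n) (punchIn c v)
punchIn-InRange c {v} (1≤v , v≤n) with punchIn-cases c v
... | inj₁ (_ , e) rewrite e = 1≤v , m≤n⇒m≤1+n v≤n
... | inj₂ (_ , e) rewrite e = s≤s z≤n , s≤s v≤n

punchOut-InRange : ∀ {n c v} → InRange (suc n) c → InRange (suc n) v → v ≢ c → InRange n (punchOut c v)
punchOut-InRange {n} {c} {suc w} (1≤c , c≤1+n) (_ , v≤1+n) v≢c with <-cmp c (suc w)
... | tri< c<v _ _ rewrite <ᵇ-true c<v = ≤-trans 1≤c (≤-pred c<v) , ≤-pred v≤1+n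
... | tri≈ _ c≡v _ = contradiction (sym c≡v) v≢c
... | tri> _ _ v<c rewrite <ᵇ-false (<⇒≤ v<c) = s≤s z≤n , ≤-pred (<-≤-trans v<c c≤1+n)

extend : List ℕ → ℕ → List ℕ
extend σ c = map (punchIn c) σ ∷ʳ c

at-extend : ∀ σ c {m} → InRange (length σ) m → at (extend σ c) m ≡ punchIn c (at σ m)
at-extend σ c m-range =
  trans (at-++ˡ (map (punchIn c) σ) (c ∷ []) (subst (λ l → InRange l _) (sym (length-map (punchIn c) σ)) m-range))
        (at-map (punchIn c) σ m-range)

at-extend-last : ∀ σ c → at (extend σ c) (suc (length σ)) ≡ c
at-extend-last σ c =
  subst (λ l → at (extend σ c) (suc l) ≡ c) (length-map (punchIn c) σ) (at-∷ʳ-last (map (punchIn c) σ) c)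

record IsPerm (n : ℕ) (π : List ℕ) : Set where
  field
    length≡ : length π ≡ n
    inRange : All (InRange n) π
    unique  : Unique π
open IsPerm

IsPerm-length : ∀ {n π} → IsPerm n π → IsPerm (length π) π
IsPerm-length {π = π} π-perm = subst (λ k → IsPerm k π) (sym (length≡ π-perm)) π-perm

length-∷ʳ : ∀ (xs : List ℕ) x → length (xs ∷ʳ x) ≡ suc (length xs)
length-∷ʳ xs x = trans (length-++ xs) (+-comm (length xs) 1)

Unique-∷ʳ⁺ : ∀ {xs : List ℕ} {c} → Unique xs → c ∉ xs → Unique (xs ∷ʳ c)
Unique-∷ʳ⁺ u c∉xs = Unique.++⁺ u ([] ∷ []) λ { (c∈xs , here refl) → c∉xs c∈xs }

Unique-∷ʳ⁻ : ∀ (xs : List ℕ) {c} → Unique (xs ∷ʳ c) → Unique xs × c ∉ xs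
Unique-∷ʳ⁻ []       _              = [] , λ ()
Unique-∷ʳ⁻ (x ∷ xs) (x∉ ∷ u) with u′ , c∉xs ← Unique-∷ʳ⁻ xs u =
  proj₁ (∷ʳ⁻ x∉) ∷ u′ , λ { (here refl) → proj₂ (∷ʳ⁻ x∉) refl ; (there c∈xs) → c∉xs c∈xs }

IsPerm-extend : ∀ {n σ c} → IsPerm n σ → InRange (suc n) c → IsPerm (suc n) (extend σ c)
IsPerm-extend {n} {σ} {c} σ-perm c-range = record
  { length≡ = trans (length-∷ʳ (map (punchIn c) σ) c)
                    (cong suc (trans (length-map (punchIn c) σ) (length≡ σ-perm)))
  ; inRange = ∷ʳ⁺ (map⁺ (All.map (punchIn-InRange c) (inRange σ-perm))) c-range
  ; unique  = Unique-∷ʳ⁺ (Unique.map⁺ (punchIn-injective c) (unique σ-perm)) c∉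
  }
  where
  c∉ : c ∉ map (punchIn c) σ
  c∉ c∈ with v , _ , c≡ ← ∈-map⁻ (punchIn c) c∈ = punchIn-≢ c v (sym c≡)

unextend : ∀ {n π} → IsPerm (suc n) π →
           ∃[ σ ] ∃[ c ] IsPerm n σ × InRange (suc n) c × extend σ c ≡ π
unextend {n} {π} π-perm with initLast π
... | []       = contradiction (length≡ π-perm) λ ()
... | xs ∷ʳ′ c = map (punchOut c) xs , c , σ-perm , proj₂ (∷ʳ⁻ (inRange π-perm)) , cong (_∷ʳ c) punchIn∘punchOut
  where
  xs-unique : Unique xs × c ∉ xs
  xs-unique = Unique-∷ʳ⁻ xs (unique π-perm)
  punchIn∘punchOut : map (punchIn c) (map (punchOut c) xs) ≡ xs
  punchIn∘punchOut = trans (sym (map-∘ xs))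
    (trans (map-cong-local (All.tabulate (λ v∈ → punchIn-punchOut {c} λ { refl → proj₂ xs-unique v∈ })))
           (map-id xs))
  σ-perm : IsPerm n (map (punchOut c) xs)
  σ-perm = record
    { length≡ = trans (length-map (punchOut c) xs) (suc-injective (trans (sym (length-∷ʳ xs c)) (length≡ π-perm)))
    ; inRange = map⁺ (All.tabulate λ {v} v∈ →
        punchOut-InRange (proj₂ (∷ʳ⁻ (inRange π-perm))) (All.lookup (proj₁ (∷ʳ⁻ (inRange π-perm))) v∈)
                         λ { refl → proj₂ xs-unique v∈ })
    ; unique  = Unique.map⁻ (subst Unique (sym punchIn∘punchOut) (proj₁ xs-unique))
    }

∈-IsPerm : ∀ {n π v} → IsPerm n π → InRange n v → v ∈ π
∈-IsPerm {zero}  _      (1≤v , v≤0) = contradiction (≤-trans 1≤v v≤0) λ ()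
∈-IsPerm {suc n} {v = v} π-perm (1≤v , v≤1+n) with unextend π-perm
... | σ , c , σ-perm , (1≤c , c≤1+n) , refl with <-cmp v c
... | tri< v<c _ _ = ∈-++⁺ˡ (subst (_∈ _) (punchIn-< v<c)
        (∈-map⁺ (punchIn c) (∈-IsPerm σ-perm (1≤v , ≤-pred (<-≤-trans v<c c≤1+n)))))
... | tri≈ _ refl _ = ∈-++⁺ʳ (map (punchIn c) σ) (here refl)
... | tri> _ _ c<v with v | c<v | v≤1+n
...   | suc w | s≤s c≤w | s≤s w≤n = ∈-++⁺ˡ (subst (_∈ _) (punchIn-≥ c≤w)
        (∈-map⁺ (punchIn c) (∈-IsPerm σ-perm (≤-trans 1≤c c≤w , w≤n))))

concatMap-∷≡cartesianProduct : ∀ (A : List ℕ) (W : List (List ℕ)) →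
  concatMap (λ x → map (x ∷_) W) A ≡ cartesianProductWith _∷_ A W
concatMap-∷≡cartesianProduct []       W = refl
concatMap-∷≡cartesianProduct (a ∷ as) W = cong (map (a ∷_) W ++_) (concatMap-∷≡cartesianProduct as W)

∈-words⁻ : ∀ A k {π} → π ∈ words A k → length π ≡ k × All (_∈ A) π
∈-words⁻ A zero    (here refl) = refl , []
∈-words⁻ A (suc k) π∈
  with x , w , x∈ , w∈ , refl ← ∈-cartesianProductWith⁻ _∷_ A (words A k)
                                  (subst (_ ∈_) (concatMap-∷≡cartesianProduct A (words A k)) π∈)
  with len , all ← ∈-words⁻ A k w∈ = cong suc len , x∈ ∷ all

∈-words⁺ : ∀ A k {π} → length π ≡ k → All (_∈ A) π → π ∈ words A k
∈-words⁺ A zero    {[]}    refl []           = here refl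
∈-words⁺ A (suc k) {x ∷ w} len  (x∈ ∷ w∈A) =
  subst (_ ∈_) (sym (concatMap-∷≡cartesianProduct A (words A k)))
        (∈-cartesianProductWith⁺ _∷_ x∈ (∈-words⁺ A k (suc-injective len) w∈A))

words-unique : ∀ {A} k → Unique A → Unique (words A k)
words-unique zero    _ = [] ∷ []
words-unique {A} (suc k) u = subst Unique (sym (concatMap-∷≡cartesianProduct A (words A k)))
  (Unique.cartesianProductWith⁺ _∷_ ∷-injective u (words-unique k u))

∉⇔not-elem : ∀ {x xs} → T (not (elem x xs)) ⇔ x ∉ xs
∉⇔not-elem {x} {xs} = mk⇔
  (λ t x∈ → Equivalence.to T-not t (any⁺ (x ≡ᵇ_) (Any.map (≡⇒≡ᵇ x _) x∈)))
  (λ x∉ → Equivalence.from T-not (x∉ ∘ Any.map (≡ᵇ⇒≡ x _) ∘ any⁻ (x ≡ᵇ_) xs))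

distinct⇔Unique : ∀ {π} → T (distinct π) ⇔ Unique π
distinct⇔Unique {[]}    = mk⇔ (λ _ → []) _
distinct⇔Unique {x ∷ π} = mk⇔
  (λ t → let x∉ , d = Equivalence.to T-∧ t
         in ¬Any⇒All¬ π (Equivalence.to ∉⇔not-elem x∉) ∷ Equivalence.to distinct⇔Unique d)
  (λ { (x∉ ∷ u) → Equivalence.from T-∧
                    (Equivalence.from ∉⇔not-elem (All¬⇒¬Any x∉) , Equivalence.from distinct⇔Unique u) })

∈-S⇔IsPerm : ∀ {n π} → π ∈ S n ⇔ IsPerm n π
∈-S⇔IsPerm {n} {π} = mk⇔ to from
  where
  to : π ∈ S n → IsPerm n π
  to π∈ with w∈ , d ← ∈-filter⁻ (λ w → distinct w Bool.≟ true) π∈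
        with len , all∈ ← ∈-words⁻ [ n ] n w∈ = record
    { length≡ = len
    ; inRange = All.map (λ v∈ → let 1≤v , v<1+n = ∈-range⁻ 1 n v∈ in 1≤v , ≤-pred v<1+n) all∈
    ; unique  = Equivalence.to distinct⇔Unique (Equivalence.from T-≡ d)
    }
  from : IsPerm n π → π ∈ S n
  from π-perm = ∈-filter⁺ (λ w → distinct w Bool.≟ true)
    (∈-words⁺ [ n ] n (length≡ π-perm)
              (All.map (λ (1≤v , v≤n) → ∈-range⁺ 1 n 1≤v (s≤s v≤n)) (inRange π-perm)))
    (T⇒≡true (Equivalence.from distinct⇔Unique (unique π-perm)))

S-unique : ∀ n → Unique (S n)
S-unique n = Unique.filter⁺ _ (words-unique n (range-unique 1 n))

-- Coding permutations by their last entries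

codes : ℕ → List (List ℕ)
codes zero    = [] ∷ []
codes (suc n) = cartesianProductWith _∷_ [ suc n ] (codes n)

decode : List ℕ → List ℕ
decode []       = []
decode (c ∷ cs) = extend (decode cs) c

[]∉codes : ∀ {n} → [] ∉ codes (suc n)
[]∉codes {n} []∈ with _ , _ , _ , _ , () ← ∈-cartesianProductWith⁻ _∷_ [ suc n ] (codes n) []∈

∈-codes⁻ : ∀ {n c cs} → c ∷ cs ∈ codes (suc n) → InRange (suc n) c × cs ∈ codes n
∈-codes⁻ {n} ccs∈ with _ , _ , c∈ , cs∈ , refl ← ∈-cartesianProductWith⁻ _∷_ [ suc n ] (codes n) ccs∈ =
  let 1≤c , c<2+n = ∈-range⁻ 1 (suc n) c∈ in (1≤c , ≤-pred c<2+n) , cs∈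

∈-codes⁺ : ∀ {n c cs} → InRange (suc n) c → cs ∈ codes n → c ∷ cs ∈ codes (suc n)
∈-codes⁺ {n} (1≤c , c≤1+n) cs∈ = ∈-cartesianProductWith⁺ _∷_ (∈-range⁺ 1 (suc n) 1≤c (s≤s c≤1+n)) cs∈

codes-unique : ∀ n → Unique (codes n)
codes-unique zero    = [] ∷ []
codes-unique (suc n) = Unique.cartesianProductWith⁺ _∷_ ∷-injective (range-unique 1 (suc n)) (codes-unique n)

IsPerm-decode : ∀ {n cs} → cs ∈ codes n → IsPerm n (decode cs)
IsPerm-decode {zero}  (here refl) = record { length≡ = refl ; inRange = [] ; unique = [] }
IsPerm-decode {suc n} {[]}     []∈  = contradiction []∈ ([]∉codes {n})
IsPerm-decode {suc n} {c ∷ cs} ccs∈ with c-range , cs∈ ← ∈-codes⁻ {n} ccs∈ =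
  IsPerm-extend (IsPerm-decode {n} cs∈) c-range

decode-surjective : ∀ {n π} → IsPerm n π → ∃[ cs ] cs ∈ codes n × decode cs ≡ π
decode-surjective {zero} {[]} _ = [] , here refl , refl
decode-surjective {zero} {_ ∷ _} π-perm = contradiction (length≡ π-perm) λ ()
decode-surjective {suc n} π-perm
  with σ , c , σ-perm , c-range , refl ← unextend π-perm
  with cs , cs∈ , refl ← decode-surjective σ-perm = c ∷ cs , ∈-codes⁺ c-range cs∈ , refl

extend≢[] : ∀ σ c → extend σ c ≢ []
extend≢[] []      c ()
extend≢[] (_ ∷ _) c ()

decode-injective : ∀ {cs cs′} → decode cs ≡ decode cs′ → cs ≡ cs′
decode-injective {[]}     {[]}       eq = refl
decode-injective {[]}     {c′ ∷ cs′} eq = contradiction (sym eq) (extend≢[] (decode cs′) c′)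
decode-injective {c ∷ cs} {[]}       eq = contradiction eq (extend≢[] (decode cs) c)
decode-injective {c ∷ cs} {c′ ∷ cs′} eq with σ≡ , refl ← ∷ʳ-injective _ _ eq =
  cong (c ∷_) (decode-injective (map-injective (punchIn-injective c) σ≡))

S↭decode-codes : ∀ n → S n ↭ map decode (codes n)
S↭decode-codes n = Unique-⊆⊇⇒↭ (S-unique n) (Unique.map⁺ {f = decode} decode-injective (codes-unique n)) to from
  where
  to : ∀ {π} → π ∈ S n → π ∈ map decode (codes n)
  to {π} π∈ with cs , cs∈ , refl ← decode-surjective (Equivalence.to (∈-S⇔IsPerm {n} {π}) π∈) =
    ∈-map⁺ decode cs∈
  from : ∀ {π} → π ∈ map decode (codes n) → π ∈ S n
  from π∈ with cs , cs∈ , refl ← ∈-map⁻ decode π∈ = Equivalence.from ∈-S⇔IsPerm (IsPerm-decode {n} cs∈)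

occ≡countᵇ : ∀ p π → occ p π ≡ countᵇ (isOcc p π) (choose (length (τ p)) [ length π ])
occ≡countᵇ p π = trans (length-filter (λ is → isOcc p π is Bool.≟ true) positions)
                       (countᵇ-≗ (does-≟-true ∘ isOcc p π) positions)
  where
  positions : List (List ℕ)
  positions = choose (length (τ p)) [ length π ]

count≡countᵇ-codes : ∀ p (stat : List ℕ → ℕ) → (∀ n {cs} → cs ∈ codes n → occ p (decode cs) ≡ stat cs) →
                     ∀ n ℓ → count p n ℓ ≡ countᵇ (λ cs → stat cs ≡ᵇ ℓ) (codes n)
count≡countᵇ-codes p stat occ≡stat n ℓ = begin
  count p n ℓ                                        ≡⟨ length-filter (λ π → occ p π ℕ.≟ ℓ) (S n) ⟩
  countᵇ (λ π → occ p π ≡ᵇ ℓ) (S n)                  ≡⟨ countᵇ-↭ _ (S↭decode-codes n) ⟩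
  countᵇ (λ π → occ p π ≡ᵇ ℓ) (map decode (codes n)) ≡⟨ countᵇ-map _ decode (codes n) ⟩
  countᵇ (λ cs → occ p (decode cs) ≡ᵇ ℓ) (codes n)
    ≡⟨ countᵇ-cong (All.tabulate λ cs∈ → cs∈) (cong (_≡ᵇ ℓ) ∘ occ≡stat n) ⟩
  countᵇ (λ cs → stat cs ≡ᵇ ℓ) (codes n)             ∎
  where open ≡-Reasoning

record Positions (k i₁ i₂ i₃ : ℕ) : Set where
  field
    1≤i₁  : 1 ≤ i₁
    i₁<i₂ : i₁ < i₂
    i₂<i₃ : i₂ < i₃
    i₃≤k  : i₃ ≤ k

  i₂≤k : i₂ ≤ k
  i₂≤k = <⇒≤ (<-≤-trans i₂<i₃ i₃≤k)

  i₁-range : InRange k i₁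
  i₁-range = 1≤i₁ , <⇒≤ (<-≤-trans i₁<i₂ i₂≤k)

  i₂-range : InRange k i₂
  i₂-range = ≤-trans 1≤i₁ (<⇒≤ i₁<i₂) , i₂≤k

  i₃-range : InRange k i₃
  i₃-range = ≤-trans (proj₁ i₂-range) (<⇒≤ i₂<i₃) , i₃≤k

  below-i₃ : ∀ {m} → 1 ≤ m → m < i₃ → InRange k m
  below-i₃ 1≤m m<i₃ = 1≤m , <⇒≤ (<-≤-trans m<i₃ i₃≤k)

open Positions

ascending⇒Positions : ∀ {k i₁ i₂ i₃} → Ascending 3 1 (suc k) (i₁ ∷ i₂ ∷ i₃ ∷ []) → Positions k i₁ i₂ i₃
ascending⇒Positions (1≤i₁ , _ , i₁<i₂ , _ , i₂<i₃ , i₃<1+k , _) = record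
  { 1≤i₁ = 1≤i₁ ; i₁<i₂ = i₁<i₂ ; i₂<i₃ = i₂<i₃ ; i₃≤k = ≤-pred i₃<1+k }

InGap : List ℕ → ℕ → ℕ → Set
InGap cuts a x = at₀ cuts a < x × x < at₀ cuts (suc a)

InLowGap : List ℕ → ℕ → Set
InLowGap cuts x = ∃[ a ] a ≤ 2 × InGap cuts a x

-- `inBox` and `boxEmpty` restate the local definitions of `isOcc`, so that
-- `isOcc (mesh τ R₃) π is` unfolds definitionally to `orderIso … ∧ emptyR₃ …`.
inBox : (ℕ → ℕ) → List ℕ → List ℕ → ℕ × ℕ → ℕ → Bool
inBox L I V (a , b) m = (at₀ I a <ᵇ m) ∧ (m <ᵇ at₀ I (suc a)) ∧ (at₀ V b <ᵇ L m) ∧ (L m <ᵇ at₀ V (suc b))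

boxEmpty : (ℕ → ℕ) → ℕ → List ℕ → List ℕ → ℕ × ℕ → Bool
boxEmpty L n I V ab = not (any (inBox L I V ab) [ n ])

emptyR₃ : (ℕ → ℕ) → ℕ → List ℕ → List ℕ → Bool
emptyR₃ L n I V = all (boxEmpty L n I V) R₃

T-inBox : ∀ {L I V a b m} → T (inBox L I V (a , b) m) ⇔ (InGap I a m × InGap V b (L m))
T-inBox = mk⇔
  (λ t → let t₁ , t₂ = Equivalence.to T-∧ t ; t₂ , t₃ = Equivalence.to T-∧ t₂ ; t₃ , t₄ = Equivalence.to T-∧ t₃
         in (<ᵇ⇒< _ _ t₁ , <ᵇ⇒< _ _ t₂) , (<ᵇ⇒< _ _ t₃ , <ᵇ⇒< _ _ t₄))
  (λ ((g₁ , g₂) , (g₃ , g₄)) →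
    Equivalence.from T-∧ (<⇒<ᵇ g₁ , Equivalence.from T-∧ (<⇒<ᵇ g₂ , Equivalence.from T-∧ (<⇒<ᵇ g₃ , <⇒<ᵇ g₄))))

T-none-range : ∀ {g : ℕ → Bool} {n} → T (not (any g [ n ])) ⇔ (∀ m → InRange n m → ¬ T (g m))
T-none-range {g} {n} = mk⇔
  (λ t m (1≤m , m≤n) gm →
    Equivalence.to T-not t (any⁺ g (Any.map (λ { refl → gm }) (∈-range⁺ 1 n 1≤m (s≤s m≤n)))))
  (λ none → Equivalence.from T-not λ t →
    let m , m∈ , gm = find (any⁻ g [ n ] t) ; 1≤m , m<1+n = ∈-range⁻ 1 n m∈ in none m (1≤m , ≤-pred m<1+n) gm)

All-R₃⁻ : ∀ {P : ℕ × ℕ → Set} → All P R₃ → ∀ {a b} → a ≤ 2 → b ≤ 2 → P (a , b)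
All-R₃⁻ {P} (p₀₀ ∷ p₀₁ ∷ p₀₂ ∷ p₁₀ ∷ p₁₁ ∷ p₁₂ ∷ p₂₀ ∷ p₂₁ ∷ p₂₂ ∷ []) = lookup
  where
  lookup : ∀ {a b} → a ≤ 2 → b ≤ 2 → P (a , b)
  lookup {0} {0} _ _ = p₀₀
  lookup {0} {1} _ _ = p₀₁
  lookup {0} {2} _ _ = p₀₂
  lookup {1} {0} _ _ = p₁₀
  lookup {1} {1} _ _ = p₁₁
  lookup {1} {2} _ _ = p₁₂
  lookup {2} {0} _ _ = p₂₀
  lookup {2} {1} _ _ = p₂₁
  lookup {2} {2} _ _ = p₂₂
  lookup {suc (suc (suc _))} (s≤s (s≤s ())) _
  lookup {_} {suc (suc (suc _))} _ (s≤s (s≤s ()))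

All-R₃⁺ : ∀ {P : ℕ × ℕ → Set} → (∀ {a b} → a ≤ 2 → b ≤ 2 → P (a , b)) → All P R₃
All-R₃⁺ p = p 0≤2 0≤2 ∷ p 0≤2 1≤2 ∷ p 0≤2 2≤2 ∷ p 1≤2 0≤2 ∷ p 1≤2 1≤2 ∷ p 1≤2 2≤2 ∷
            p 2≤2 0≤2 ∷ p 2≤2 1≤2 ∷ p 2≤2 2≤2 ∷ []
  where
  0≤2 : 0 ≤ 2
  0≤2 = z≤n
  1≤2 : 1 ≤ 2
  1≤2 = s≤s z≤n
  2≤2 : 2 ≤ 2
  2≤2 = ≤-refl

T-emptyR₃ : ∀ {L n I V} → T (emptyR₃ L n I V) ⇔ (∀ m → InRange n m → InLowGap I m → InLowGap V (L m) → ⊥)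
T-emptyR₃ {L} {n} {I} {V} = mk⇔
  (λ t m m-range (a , a≤2 , gI) (b , b≤2 , gV) →
    Equivalence.to (T-none-range {inBox L I V (a , b)})
                   (All-R₃⁻ (all⁺ (boxEmpty L n I V) R₃ t) a≤2 b≤2) m m-range
                   (Equivalence.from (T-inBox {L} {I} {V} {a} {b}) (gI , gV)))
  (λ none → all⁻ (boxEmpty L n I V) (All-R₃⁺ λ {a} {b} a≤2 b≤2 →
    Equivalence.from (T-none-range {inBox L I V (a , b)}) λ m m-range t →
    let gI , gV = Equivalence.to (T-inBox {L} {I} {V} {a} {b}) t in none m m-range (a , a≤2 , gI) (b , b≤2 , gV)))

InLowGap⇔ : ∀ {p₁ p₂ p₃ rest x} → p₁ < p₂ → p₂ < p₃ →
            InLowGap (0 ∷ p₁ ∷ p₂ ∷ p₃ ∷ rest) x ⇔ (1 ≤ x × x < p₃ × x ≢ p₁ × x ≢ p₂)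
InLowGap⇔ {p₁} {p₂} {p₃} {rest} {x} p₁<p₂ p₂<p₃ = mk⇔ to from
  where
  to : InLowGap (0 ∷ p₁ ∷ p₂ ∷ p₃ ∷ rest) x → 1 ≤ x × x < p₃ × x ≢ p₁ × x ≢ p₂
  to (0 , _ , 0<x , x<p₁) = 0<x , <-trans x<p₁ (<-trans p₁<p₂ p₂<p₃) , <⇒≢ x<p₁ , <⇒≢ (<-trans x<p₁ p₁<p₂)
  to (1 , _ , p₁<x , x<p₂) = ≤-trans (s≤s z≤n) p₁<x , <-trans x<p₂ p₂<p₃ , >⇒≢ p₁<x , <⇒≢ x<p₂
  to (2 , _ , p₂<x , x<p₃) = ≤-trans (s≤s z≤n) p₂<x , x<p₃ , >⇒≢ (<-trans p₁<p₂ p₂<x) , >⇒≢ p₂<x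
  to (suc (suc (suc _)) , s≤s (s≤s ()) , _)
  from : 1 ≤ x × x < p₃ × x ≢ p₁ × x ≢ p₂ → InLowGap (0 ∷ p₁ ∷ p₂ ∷ p₃ ∷ rest) x
  from (1≤x , x<p₃ , x≢p₁ , x≢p₂) with <-cmp x p₁ | <-cmp x p₂
  ... | tri< x<p₁ _ _ | _              = 0 , z≤n , 1≤x , x<p₁
  ... | tri≈ _ x≡p₁ _ | _              = contradiction x≡p₁ x≢p₁
  ... | tri> _ _ p₁<x | tri< x<p₂ _ _ = 1 , s≤s z≤n , p₁<x , x<p₂
  ... | tri> _ _ _    | tri≈ _ x≡p₂ _ = contradiction x≡p₂ x≢p₂
  ... | tri> _ _ _    | tri> _ _ p₂<x = 2 , ≤-refl , p₂<x , x<p₃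

-- The region shaded by R₃ for an occurrence at i₁ < i₂ < i₃ whose largest value is v.
Clear : (ℕ → ℕ) → ℕ → ℕ → ℕ → ℕ → Set
Clear L i₁ i₂ i₃ v = ∀ m → 1 ≤ m → m < i₃ → m ≢ i₁ → m ≢ i₂ → v < L m

module _ {L : ℕ → ℕ} {n i₁ i₂ i₃ v₁ v₂ v₃ : ℕ}
         (pos : Positions n i₁ i₂ i₃) (v₁<v₂ : v₁ < v₂) (v₂<v₃ : v₂ < v₃)
         (fresh : ∀ m → 1 ≤ m → m < i₃ → m ≢ i₁ → m ≢ i₂ → 1 ≤ L m × L m ≢ v₁ × L m ≢ v₂ × L m ≢ v₃)
         where

  emptyR₃⇔Clear : T (emptyR₃ L n (0 ∷ i₁ ∷ i₂ ∷ i₃ ∷ suc n ∷ []) (0 ∷ v₁ ∷ v₂ ∷ v₃ ∷ suc n ∷ [])) ⇔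
                  Clear L i₁ i₂ i₃ v₃
  emptyR₃⇔Clear = mk⇔ to from
    where
    I V : List ℕ
    I = 0 ∷ i₁ ∷ i₂ ∷ i₃ ∷ suc n ∷ []
    V = 0 ∷ v₁ ∷ v₂ ∷ v₃ ∷ suc n ∷ []
    to : T (emptyR₃ L n I V) → Clear L i₁ i₂ i₃ v₃
    to t m 1≤m m<i₃ m≢i₁ m≢i₂ with 1≤Lm , Lm≢v₁ , Lm≢v₂ , Lm≢v₃ ← fresh m 1≤m m<i₃ m≢i₁ m≢i₂
                              with <-cmp v₃ (L m)
    ... | tri< v₃<Lm _ _ = v₃<Lm
    ... | tri≈ _ v₃≡Lm _ = contradiction (sym v₃≡Lm) Lm≢v₃
    ... | tri> _ _ Lm<v₃ = ⊥-elim (Equivalence.to (T-emptyR₃ {L} {n} {I} {V}) t m (below-i₃ pos 1≤m m<i₃)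
          (Equivalence.from (InLowGap⇔ (i₁<i₂ pos) (i₂<i₃ pos)) (1≤m , m<i₃ , m≢i₁ , m≢i₂))
          (Equivalence.from (InLowGap⇔ v₁<v₂ v₂<v₃) (1≤Lm , Lm<v₃ , Lm≢v₁ , Lm≢v₂)))
    from : Clear L i₁ i₂ i₃ v₃ → T (emptyR₃ L n I V)
    from clear = Equivalence.from (T-emptyR₃ {L} {n} {I} {V}) λ m _ gI gV →
      let 1≤m , m<i₃ , m≢i₁ , m≢i₂ = Equivalence.to (InLowGap⇔ (i₁<i₂ pos) (i₂<i₃ pos)) gI
          _ , Lm<v₃ , _ = Equivalence.to (InLowGap⇔ v₁<v₂ v₂<v₃) gV
      in <-asym Lm<v₃ (clear m 1≤m m<i₃ m≢i₁ m≢i₂)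

-- Occurrences of (123, R₃) and (132, R₃)

orderCell : List ℕ → List ℕ → ℕ → ℕ → Bool
orderCell u τ a b = eqB (at u a <ᵇ at u b) (at τ a <ᵇ at τ b)

orderRow : List ℕ → List ℕ → ℕ → Bool
orderRow u τ a = all (orderCell u τ a) [ length τ ]

T-orderCell : ∀ {u τ a b} → T (at τ a <ᵇ at τ b) → T (orderCell u τ a b) → at u a < at u b
T-orderCell {u} {τ} {a} {b} τa<τb t with at u a <ᵇ at u b in ua<ub | at τ a <ᵇ at τ b
... | true | true = <ᵇ⇒< _ _ (subst T (sym ua<ub) _)

orderIso-cells : ∀ {u τ} → T (orderIso u τ) →
                 ∀ {a b} → a ∈ [ length τ ] → b ∈ [ length τ ] → T (orderCell u τ a b)
orderIso-cells {u} {τ} t {a} a∈ b∈ =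
  All.lookup (all⁺ (orderCell u τ a) [ length τ ]
    (All.lookup (all⁺ (orderRow u τ) [ length τ ]
      (proj₂ (Equivalence.to (T-∧ {length u ≡ᵇ length τ}) t))) a∈)) b∈

orderIso-123⇔ : ∀ {x y z} → T (orderIso (x ∷ y ∷ z ∷ []) (1 ∷ 2 ∷ 3 ∷ [])) ⇔ (x < y × y < z)
orderIso-123⇔ {x} {y} {z} = mk⇔
  (λ t → T-orderCell {u} {t₁₂₃} {1} {2} _ (orderIso-cells {u} {t₁₂₃} t (here refl) (there (here refl))) ,
         T-orderCell {u} {t₁₂₃} {2} {3} _ (orderIso-cells {u} {t₁₂₃} t (there (here refl)) (there (there (here refl)))))
  (λ (x<y , y<z) → Equivalence.from T-≡ (lemma x<y y<z))
  where
  u t₁₂₃ : List ℕ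
  u = x ∷ y ∷ z ∷ []
  t₁₂₃ = 1 ∷ 2 ∷ 3 ∷ []
  lemma : x < y → y < z → orderIso (x ∷ y ∷ z ∷ []) (1 ∷ 2 ∷ 3 ∷ []) ≡ true
  lemma x<y y<z rewrite <ᵇ-irrefl x | <ᵇ-irrefl y | <ᵇ-irrefl z | <ᵇ-true x<y | <ᵇ-true y<z | <ᵇ-true (<-trans x<y y<z)
    | <ᵇ-false (<⇒≤ x<y) | <ᵇ-false (<⇒≤ y<z) | <ᵇ-false (<⇒≤ (<-trans x<y y<z)) = refl

orderIso-132⇔ : ∀ {x y z} → T (orderIso (x ∷ y ∷ z ∷ []) (1 ∷ 3 ∷ 2 ∷ [])) ⇔ (x < z × z < y)
orderIso-132⇔ {x} {y} {z} = mk⇔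
  (λ t → T-orderCell {u} {t₁₃₂} {1} {3} _ (orderIso-cells {u} {t₁₃₂} t (here refl) (there (there (here refl)))) ,
         T-orderCell {u} {t₁₃₂} {3} {2} _ (orderIso-cells {u} {t₁₃₂} t (there (there (here refl))) (there (here refl))))
  (λ (x<z , z<y) → Equivalence.from T-≡ (lemma x<z z<y))
  where
  u t₁₃₂ : List ℕ
  u = x ∷ y ∷ z ∷ []
  t₁₃₂ = 1 ∷ 3 ∷ 2 ∷ []
  lemma : x < z → z < y → orderIso (x ∷ y ∷ z ∷ []) (1 ∷ 3 ∷ 2 ∷ []) ≡ true
  lemma x<z z<y rewrite <ᵇ-irrefl x | <ᵇ-irrefl y | <ᵇ-irrefl z | <ᵇ-true x<z | <ᵇ-true z<y | <ᵇ-true (<-trans x<z z<y)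
    | <ᵇ-false (<⇒≤ x<z) | <ᵇ-false (<⇒≤ z<y) | <ᵇ-false (<⇒≤ (<-trans x<z z<y)) = refl

sort-123 : ∀ {x y z} → x < y → y < z → sort (x ∷ y ∷ z ∷ []) ≡ x ∷ y ∷ z ∷ []
sort-123 x<y y<z rewrite <ᵇ-true y<z | <ᵇ-true x<y = refl

sort-132 : ∀ {x y z} → x < z → z < y → sort (x ∷ y ∷ z ∷ []) ≡ x ∷ z ∷ y ∷ []
sort-132 x<z z<y rewrite <ᵇ-false (<⇒≤ z<y) | <ᵇ-true x<z = refl

Occ123 Occ132 : (ℕ → ℕ) → ℕ → ℕ → ℕ → Set
Occ123 L i₁ i₂ i₃ = L i₁ < L i₂ × L i₂ < L i₃ × Clear L i₁ i₂ i₃ (L i₃)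
Occ132 L i₁ i₂ i₃ = L i₁ < L i₃ × L i₃ < L i₂ × Clear L i₁ i₂ i₃ (L i₂)

p123 p132 : MeshPattern
p123 = mesh (1 ∷ 2 ∷ 3 ∷ []) R₃
p132 = mesh (1 ∷ 3 ∷ 2 ∷ []) R₃

module _ {n π} (π-perm : IsPerm n π) {i₁ i₂ i₃} (pos : Positions (length π) i₁ i₂ i₃) where

  private
    L : ℕ → ℕ
    L = at π
    N : ℕ
    N = length π

    I : List ℕ
    I = 0 ∷ i₁ ∷ i₂ ∷ i₃ ∷ suc N ∷ []

    fresh : ∀ m → 1 ≤ m → m < i₃ → m ≢ i₁ → m ≢ i₂ → 1 ≤ L m × L m ≢ L i₁ × L m ≢ L i₂ × L m ≢ L i₃
    fresh m 1≤m m<i₃ m≢i₁ m≢i₂ =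
      proj₁ (All.lookup (inRange π-perm) (at-∈ π m-range)) ,
      m≢i₁ ∘ at-injective (unique π-perm) m-range (i₁-range pos) ,
      m≢i₂ ∘ at-injective (unique π-perm) m-range (i₂-range pos) ,
      <⇒≢ m<i₃ ∘ at-injective (unique π-perm) m-range (i₃-range pos)
      where
      m-range : InRange N m
      m-range = below-i₃ pos 1≤m m<i₃

  isOcc-123⇔ : T (isOcc p123 π (i₁ ∷ i₂ ∷ i₃ ∷ [])) ⇔ Occ123 L i₁ i₂ i₃
  isOcc-123⇔ = mk⇔ to from
    where
    to : T (isOcc p123 π (i₁ ∷ i₂ ∷ i₃ ∷ [])) → Occ123 L i₁ i₂ i₃
    to t with o , e ← Equivalence.to (T-∧ {orderIso (L i₁ ∷ L i₂ ∷ L i₃ ∷ []) (τ p123)}) t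
         with x<y , y<z ← Equivalence.to orderIso-123⇔ o =
      x<y , y<z , Equivalence.to (emptyR₃⇔Clear pos x<y y<z fresh)
                    (subst (λ vs → T (emptyR₃ L N I (0 ∷ vs ++ suc N ∷ []))) (sort-123 x<y y<z) e)
    from : Occ123 L i₁ i₂ i₃ → T (isOcc p123 π (i₁ ∷ i₂ ∷ i₃ ∷ []))
    from (x<y , y<z , clear) = Equivalence.from T-∧ (Equivalence.from orderIso-123⇔ (x<y , y<z) ,
      subst (λ vs → T (emptyR₃ L N I (0 ∷ vs ++ suc N ∷ []))) (sym (sort-123 x<y y<z))
            (Equivalence.from (emptyR₃⇔Clear pos x<y y<z fresh) clear))

  isOcc-132⇔ : T (isOcc p132 π (i₁ ∷ i₂ ∷ i₃ ∷ [])) ⇔ Occ132 L i₁ i₂ i₃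
  isOcc-132⇔ = mk⇔ to from
    where
    fresh′ : ∀ m → 1 ≤ m → m < i₃ → m ≢ i₁ → m ≢ i₂ → 1 ≤ L m × L m ≢ L i₁ × L m ≢ L i₃ × L m ≢ L i₂
    fresh′ m 1≤m m<i₃ m≢i₁ m≢i₂ with 1≤Lm , ≢₁ , ≢₂ , ≢₃ ← fresh m 1≤m m<i₃ m≢i₁ m≢i₂ =
      1≤Lm , ≢₁ , ≢₃ , ≢₂
    to : T (isOcc p132 π (i₁ ∷ i₂ ∷ i₃ ∷ [])) → Occ132 L i₁ i₂ i₃
    to t with o , e ← Equivalence.to (T-∧ {orderIso (L i₁ ∷ L i₂ ∷ L i₃ ∷ []) (τ p132)}) t
         with x<z , z<y ← Equivalence.to orderIso-132⇔ o =
      x<z , z<y , Equivalence.to (emptyR₃⇔Clear pos x<z z<y fresh′)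
                    (subst (λ vs → T (emptyR₃ L N I (0 ∷ vs ++ suc N ∷ []))) (sort-132 x<z z<y) e)
    from : Occ132 L i₁ i₂ i₃ → T (isOcc p132 π (i₁ ∷ i₂ ∷ i₃ ∷ []))
    from (x<z , z<y , clear) = Equivalence.from T-∧ (Equivalence.from orderIso-132⇔ (x<z , z<y) ,
      subst (λ vs → T (emptyR₃ L N I (0 ∷ vs ++ suc N ∷ []))) (sym (sort-132 x<z z<y))
            (Equivalence.from (emptyR₃⇔Clear pos x<z z<y fresh′) clear))

SameOrderOn : ℕ → (ℕ → ℕ) → (ℕ → ℕ) → Set
SameOrderOn k L L′ = ∀ {u v} → InRange k u → InRange k v → L u < L v → L′ u < L′ v

module _ {k L L′ i₁ i₂ i₃} (same : SameOrderOn k L L′) (pos : Positions k i₁ i₂ i₃) where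

  Clear-transfer : ∀ {i} → InRange k i → Clear L i₁ i₂ i₃ (L i) → Clear L′ i₁ i₂ i₃ (L′ i)
  Clear-transfer i-range clear m 1≤m m<i₃ m≢i₁ m≢i₂ =
    same i-range (below-i₃ pos 1≤m m<i₃) (clear m 1≤m m<i₃ m≢i₁ m≢i₂)

  Occ123-transfer : Occ123 L i₁ i₂ i₃ → Occ123 L′ i₁ i₂ i₃
  Occ123-transfer (x<y , y<z , clear) =
    same (i₁-range pos) (i₂-range pos) x<y , same (i₂-range pos) (i₃-range pos) y<z ,
    Clear-transfer (i₃-range pos) clear

  Occ132-transfer : Occ132 L i₁ i₂ i₃ → Occ132 L′ i₁ i₂ i₃
  Occ132-transfer (x<z , z<y , clear) =
    same (i₁-range pos) (i₃-range pos) x<z , same (i₃-range pos) (i₂-range pos) z<y ,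
    Clear-transfer (i₂-range pos) clear

-- Occurrences in an extended permutation

lowest-two : ∀ {x y w} → 1 ≤ x → x < y → y < w → (∀ {v} → 1 ≤ v → v < w → x ≡ v ⊎ y ≡ v) → x ≡ 1 × y ≡ 2
lowest-two {x} {y} {w} 1≤x x<y y<w below = x≡1 , y≡2
  where
  x≡1 : x ≡ 1
  x≡1 with below {1} ≤-refl (<-trans (≤-<-trans 1≤x x<y) y<w)
  ... | inj₁ x≡1 = x≡1
  ... | inj₂ refl = contradiction (<-≤-trans x<y ≤-refl) (≤⇒≯ 1≤x)
  y≡2 : y ≡ 2
  y≡2 with below {2} (s≤s z≤n) (≤-<-trans (subst (λ x → suc x ≤ y) x≡1 x<y) y<w)
  ... | inj₁ x≡2 = contradiction (trans (sym x≡1) x≡2) λ ()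
  ... | inj₂ y≡2 = y≡2

module _ {σ} (σ-perm : IsPerm (length σ) σ) {i₁ i₂}
         (i₁-range : InRange (length σ) i₁) (i₂-range : InRange (length σ) i₂) where

  values-below : ∀ {w} → w ≤ suc (length σ) →
                 (∀ m → InRange (length σ) m → m ≢ i₁ → m ≢ i₂ → w ≤ at σ m) →
                 ∀ {v} → 1 ≤ v → v < w → at σ i₁ ≡ v ⊎ at σ i₂ ≡ v
  values-below w≤1+l others 1≤v v<w
    with m , m-range , σm≡v ← ∈⇒at (∈-IsPerm σ-perm (1≤v , ≤-pred (<-≤-trans v<w w≤1+l)))
    with m ≟ i₁ | m ≟ i₂
  ... | yes refl | _        = inj₁ σm≡v
  ... | no _     | yes refl = inj₂ σm≡v
  ... | no m≢i₁  | no m≢i₂  = contradiction (subst (_ ≤_) σm≡v (others m m-range m≢i₁ m≢i₂)) (<⇒≱ v<w)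

  others-≥3 : at σ i₁ ≡ 1 → at σ i₂ ≡ 2 → ∀ m → InRange (length σ) m → m ≢ i₁ → m ≢ i₂ → 3 ≤ at σ m
  others-≥3 σ₁≡1 σ₂≡2 m m-range m≢i₁ m≢i₂
    with at σ m in σm | All.lookup (inRange σ-perm) (at-∈ σ m-range)
  ... | 1 | _ = contradiction (at-injective (unique σ-perm) m-range i₁-range (trans σm (sym σ₁≡1))) m≢i₁
  ... | 2 | _ = contradiction (at-injective (unique σ-perm) m-range i₂-range (trans σm (sym σ₂≡2))) m≢i₂
  ... | suc (suc (suc _)) | _ = s≤s (s≤s (s≤s z≤n))

is12 : List ℕ → Bool
is12 (x ∷ y ∷ []) = (x ≡ᵇ 1) ∧ (y ≡ᵇ 2)
is12 _            = false

count12 : List ℕ → ℕ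
count12 σ = countᵇ is12 (choose 2 σ)

count12-positions : ∀ σ → countᵇ (is12 ∘ map (at σ)) (choose 2 [ length σ ]) ≡ count12 σ
count12-positions σ = begin
  countᵇ (is12 ∘ map (at σ)) (choose 2 positions)      ≡⟨ countᵇ-map is12 (map (at σ)) (choose 2 positions) ⟨
  countᵇ is12 (map (map (at σ)) (choose 2 positions)) ≡⟨ cong (countᵇ is12) (choose-map (at σ) 2 positions) ⟨
  countᵇ is12 (choose 2 (map (at σ) positions))       ≡⟨ cong (countᵇ is12 ∘ choose 2) (map-at-[] σ) ⟩
  count12 σ                                           ∎
  where
  open ≡-Reasoning
  positions : List ℕ
  positions = [ length σ ]

is12-punchIn-1 : ∀ t → is12 (map (punchIn 1) t) ≡ false
is12-punchIn-1 (x ∷ y ∷ []) rewrite ≡ᵇ-false (punchIn-≢ 1 x) = refl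
is12-punchIn-1 []                = refl
is12-punchIn-1 (_ ∷ [])          = refl
is12-punchIn-1 (_ ∷ _ ∷ _ ∷ _)   = refl

is12-punchIn-2 : ∀ t → is12 (map (punchIn 2) t) ≡ false
is12-punchIn-2 (x ∷ y ∷ []) rewrite ≡ᵇ-false (punchIn-≢ 2 y) = ∧-zeroʳ _
is12-punchIn-2 []                = refl
is12-punchIn-2 (_ ∷ [])          = refl
is12-punchIn-2 (_ ∷ _ ∷ _ ∷ _)   = refl

is12-punchIn : ∀ {c} → 2 < c → ∀ t → is12 (map (punchIn c) t) ≡ is12 t
is12-punchIn 2<c (x ∷ y ∷ []) = cong₂ _∧_ (punchIn-≡ᵇ (<-trans (s≤s (s≤s z≤n)) 2<c) x) (punchIn-≡ᵇ 2<c y)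
is12-punchIn 2<c []              = refl
is12-punchIn 2<c (_ ∷ [])        = refl
is12-punchIn 2<c (_ ∷ _ ∷ _ ∷ _) = refl

module Extension {n σ c} (σ-perm₀ : IsPerm n σ) (c-range₀ : InRange (suc n) c) where

  private
    l : ℕ
    l = length σ
    π : List ℕ
    π = extend σ c

    σ-perm : IsPerm l σ
    σ-perm = IsPerm-length σ-perm₀

    c-range : InRange (suc l) c
    c-range = subst (λ k → InRange (suc k) c) (sym (length≡ σ-perm₀)) c-range₀

    π-perm : IsPerm (suc l) π
    π-perm = IsPerm-extend σ-perm c-range

    at-π : ∀ {m} → InRange l m → at π m ≡ punchIn c (at σ m)
    at-π = at-extend σ c

    at-π-last : at π (suc l) ≡ c
    at-π-last = at-extend-last σ c

    sameOrder⁺ : SameOrderOn l (at σ) (at π)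
    sameOrder⁺ u-range v-range lt = subst₂ _<_ (sym (at-π u-range)) (sym (at-π v-range)) (punchIn-mono-< c lt)

    sameOrder⁻ : SameOrderOn l (at π) (at σ)
    sameOrder⁻ u-range v-range lt = punchIn-cancel-< c (subst₂ _<_ (at-π u-range) (at-π v-range) lt)

    Positions-π : ∀ {i₁ i₂ i₃} → Positions l i₁ i₂ i₃ → Positions (length π) i₁ i₂ i₃
    Positions-π pos = record
      { 1≤i₁ = 1≤i₁ pos ; i₁<i₂ = i₁<i₂ pos ; i₂<i₃ = i₂<i₃ pos
      ; i₃≤k = ≤-trans (i₃≤k pos) (≤-trans (n≤1+n l) (≤-reflexive (sym (length≡ π-perm)))) }

  isOcc-123-old : ∀ {i₁ i₂ i₃} → Positions l i₁ i₂ i₃ →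
                  isOcc p123 π (i₁ ∷ i₂ ∷ i₃ ∷ []) ≡ isOcc p123 σ (i₁ ∷ i₂ ∷ i₃ ∷ [])
  isOcc-123-old pos = T-⇔→≡ (⇔-sym (isOcc-123⇔ σ-perm pos) ⇔-∘
    (mk⇔ (Occ123-transfer sameOrder⁻ pos) (Occ123-transfer sameOrder⁺ pos) ⇔-∘ isOcc-123⇔ π-perm (Positions-π pos)))

  isOcc-132-old : ∀ {i₁ i₂ i₃} → Positions l i₁ i₂ i₃ →
                  isOcc p132 π (i₁ ∷ i₂ ∷ i₃ ∷ []) ≡ isOcc p132 σ (i₁ ∷ i₂ ∷ i₃ ∷ [])
  isOcc-132-old pos = T-⇔→≡ (⇔-sym (isOcc-132⇔ σ-perm pos) ⇔-∘
    (mk⇔ (Occ132-transfer sameOrder⁻ pos) (Occ132-transfer sameOrder⁺ pos) ⇔-∘ isOcc-132⇔ π-perm (Positions-π pos)))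

  module _ {i₁ i₂} (1≤i₁ : 1 ≤ i₁) (i₁<i₂ : i₁ < i₂) (i₂≤l : i₂ ≤ l) where

    private
      pos : Positions (length π) i₁ i₂ (suc l)
      pos = record { 1≤i₁ = 1≤i₁ ; i₁<i₂ = i₁<i₂ ; i₂<i₃ = s≤s i₂≤l ; i₃≤k = ≤-reflexive (sym (length≡ π-perm)) }

      range₁ : InRange l i₁
      range₁ = 1≤i₁ , <⇒≤ (<-≤-trans i₁<i₂ i₂≤l)

      range₂ : InRange l i₂
      range₂ = ≤-trans 1≤i₁ (<⇒≤ i₁<i₂) , i₂≤l

      1≤σ₁ : 1 ≤ at σ i₁
      1≤σ₁ = proj₁ (All.lookup (inRange σ-perm) (at-∈ σ range₁))

      others-above-3 : c ≤ 3 → at σ i₁ ≡ 1 → at σ i₂ ≡ 2 →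
                       ∀ m → 1 ≤ m → m < suc l → m ≢ i₁ → m ≢ i₂ → 3 < at π m
      others-above-3 c≤3 σ₁≡1 σ₂≡2 m 1≤m m<1+l m≢i₁ m≢i₂ =
        subst (3 <_) (sym (trans (at-π m-range) (punchIn-≥ (≤-trans c≤3 3≤σm)))) (s≤s 3≤σm)
        where
        m-range : InRange l m
        m-range = 1≤m , ≤-pred m<1+l
        3≤σm : 3 ≤ at σ m
        3≤σm = others-≥3 σ-perm range₁ range₂ σ₁≡1 σ₂≡2 m m-range m≢i₁ m≢i₂

    isOcc-123-last : T (isOcc p123 π (i₁ ∷ i₂ ∷ suc l ∷ [])) ⇔ (c ≡ 3 × at σ i₁ ≡ 1 × at σ i₂ ≡ 2)
    isOcc-123-last = mk⇔ to from ⇔-∘ isOcc-123⇔ π-perm pos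
      where
      to : Occ123 (at π) i₁ i₂ (suc l) → c ≡ 3 × at σ i₁ ≡ 1 × at σ i₂ ≡ 2
      to (x<y , y<z , clear) = c≡3 , σ₁≡1 , σ₂≡2
        where
        σ₂<c : at σ i₂ < c
        σ₂<c = punchIn<⇒< (subst₂ _<_ (at-π range₂) at-π-last y<z)
        others : ∀ m → InRange l m → m ≢ i₁ → m ≢ i₂ → c ≤ at σ m
        others m m-range m≢i₁ m≢i₂ =
          <punchIn⇒≤ (subst₂ _<_ at-π-last (at-π m-range)
                              (clear m (proj₁ m-range) (s≤s (proj₂ m-range)) m≢i₁ m≢i₂))
        below : ∀ {v} → 1 ≤ v → v < c → at σ i₁ ≡ v ⊎ at σ i₂ ≡ v
        below = values-below σ-perm range₁ range₂ (proj₂ c-range) others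
        σ₁σ₂≡12 : at σ i₁ ≡ 1 × at σ i₂ ≡ 2
        σ₁σ₂≡12 = lowest-two 1≤σ₁ (sameOrder⁻ range₁ range₂ x<y) σ₂<c below
        σ₁≡1 : at σ i₁ ≡ 1
        σ₁≡1 = proj₁ σ₁σ₂≡12
        σ₂≡2 : at σ i₂ ≡ 2
        σ₂≡2 = proj₂ σ₁σ₂≡12
        c≡3 : c ≡ 3
        c≡3 with <-cmp 3 c
        ... | tri< 3<c _ _ with below {3} (s≤s z≤n) 3<c
        ...   | inj₁ σ₁≡3 = contradiction (trans (sym σ₁≡1) σ₁≡3) λ ()
        ...   | inj₂ σ₂≡3 = contradiction (trans (sym σ₂≡2) σ₂≡3) λ ()
        c≡3 | tri≈ _ 3≡c _ = sym 3≡c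
        c≡3 | tri> _ _ c<3 = contradiction (subst (_< c) σ₂≡2 σ₂<c) (≤⇒≯ (≤-pred c<3))
      from : c ≡ 3 × at σ i₁ ≡ 1 × at σ i₂ ≡ 2 → Occ123 (at π) i₁ i₂ (suc l)
      from (refl , σ₁≡1 , σ₂≡2) =
        sameOrder⁺ range₁ range₂ (subst₂ _<_ (sym σ₁≡1) (sym σ₂≡2) (s≤s (s≤s z≤n))) ,
        subst₂ _<_ (sym (trans (at-π range₂) (cong (punchIn 3) σ₂≡2))) (sym at-π-last) (s≤s (s≤s (s≤s z≤n))) ,
        λ m 1≤m m<1+l m≢i₁ m≢i₂ →
          subst (_< at π m) (sym at-π-last) (others-above-3 ≤-refl σ₁≡1 σ₂≡2 m 1≤m m<1+l m≢i₁ m≢i₂)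

    isOcc-132-last : T (isOcc p132 π (i₁ ∷ i₂ ∷ suc l ∷ [])) ⇔ (c ≡ 2 × at σ i₁ ≡ 1 × at σ i₂ ≡ 2)
    isOcc-132-last = mk⇔ to from ⇔-∘ isOcc-132⇔ π-perm pos
      where
      to : Occ132 (at π) i₁ i₂ (suc l) → c ≡ 2 × at σ i₁ ≡ 1 × at σ i₂ ≡ 2
      to (x<z , z<y , clear) = c≡2 , σ₁≡1 , σ₂≡2
        where
        σ₁<c : at σ i₁ < c
        σ₁<c = punchIn<⇒< (subst₂ _<_ (at-π range₁) at-π-last x<z)
        c≤σ₂ : c ≤ at σ i₂
        c≤σ₂ = <punchIn⇒≤ (subst₂ _<_ at-π-last (at-π range₂) z<y)
        others : ∀ m → InRange l m → m ≢ i₁ → m ≢ i₂ → suc (at σ i₂) ≤ at σ m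
        others m m-range m≢i₁ m≢i₂ =
          sameOrder⁻ range₂ m-range (clear m (proj₁ m-range) (s≤s (proj₂ m-range)) m≢i₁ m≢i₂)
        below : ∀ {v} → 1 ≤ v → v < suc (at σ i₂) → at σ i₁ ≡ v ⊎ at σ i₂ ≡ v
        below = values-below σ-perm range₁ range₂
                  (s≤s (proj₂ (All.lookup (inRange σ-perm) (at-∈ σ range₂)))) others
        σ₁σ₂≡12 : at σ i₁ ≡ 1 × at σ i₂ ≡ 2
        σ₁σ₂≡12 = lowest-two 1≤σ₁ (<-≤-trans σ₁<c c≤σ₂) ≤-refl below
        σ₁≡1 : at σ i₁ ≡ 1
        σ₁≡1 = proj₁ σ₁σ₂≡12
        σ₂≡2 : at σ i₂ ≡ 2
        σ₂≡2 = proj₂ σ₁σ₂≡12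
        c≡2 : c ≡ 2
        c≡2 = ≤-antisym (subst (c ≤_) σ₂≡2 c≤σ₂) (subst (_< c) σ₁≡1 σ₁<c)
      from : c ≡ 2 × at σ i₁ ≡ 1 × at σ i₂ ≡ 2 → Occ132 (at π) i₁ i₂ (suc l)
      from (refl , σ₁≡1 , σ₂≡2) =
        subst₂ _<_ (sym (trans (at-π range₁) (cong (punchIn 2) σ₁≡1))) (sym at-π-last) (s≤s (s≤s z≤n)) ,
        subst₂ _<_ (sym at-π-last) (sym π₂≡3) (s≤s (s≤s (s≤s z≤n))) ,
        λ m 1≤m m<1+l m≢i₁ m≢i₂ →
          subst (_< at π m) (sym π₂≡3) (others-above-3 (n≤1+n 2) σ₁≡1 σ₂≡2 m 1≤m m<1+l m≢i₁ m≢i₂)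
        where
        π₂≡3 : at π i₂ ≡ 3
        π₂≡3 = trans (at-π range₂) (cong (punchIn 2) σ₂≡2)

  occ-extend : ∀ p t → length (τ p) ≡ 3 →
    (∀ {i₁ i₂ i₃} → Positions l i₁ i₂ i₃ → isOcc p π (i₁ ∷ i₂ ∷ i₃ ∷ []) ≡ isOcc p σ (i₁ ∷ i₂ ∷ i₃ ∷ [])) →
    (∀ {i₁ i₂} → 1 ≤ i₁ → i₁ < i₂ → i₂ ≤ l →
       T (isOcc p π (i₁ ∷ i₂ ∷ suc l ∷ [])) ⇔ (c ≡ t × at σ i₁ ≡ 1 × at σ i₂ ≡ 2)) →
    occ p π ≡ occ p σ + (if c ≡ᵇ t then count12 σ else 0)
  occ-extend p t τ₃ old new = begin
    occ p π
      ≡⟨ occ≡countᵇ p π ⟩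
    countᵇ (isOcc p π) (choose (length (τ p)) [ length π ])
      ≡⟨ cong₂ (λ k m → countᵇ (isOcc p π) (choose k [ m ])) τ₃ (length≡ π-perm) ⟩
    countᵇ (isOcc p π) (choose 3 [ suc l ])
      ≡⟨ cong (countᵇ (isOcc p π) ∘ choose 3) (range-∷ʳ 1 l) ⟩
    countᵇ (isOcc p π) (choose 3 ([ l ] ∷ʳ suc l))
      ≡⟨ countᵇ-choose-∷ʳ (isOcc p π) 2 [ l ] (suc l) ⟩
    countᵇ (isOcc p π) (choose 3 [ l ]) + countᵇ (isOcc p π ∘ (_∷ʳ suc l)) (choose 2 [ l ])
      ≡⟨ cong₂ _+_ (countᵇ-cong (choose-ascending 3 1 l) old′) (countᵇ-cong (choose-ascending 2 1 l) new′) ⟩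
    countᵇ (isOcc p σ) (choose 3 [ l ]) + countᵇ (λ is → (c ≡ᵇ t) ∧ is12 (map (at σ) is)) (choose 2 [ l ])
      ≡⟨ cong₂ _+_ (sym (trans (occ≡countᵇ p σ) (cong (λ k → countᵇ (isOcc p σ) (choose k [ l ])) τ₃)))
                   (countᵇ-∧ˡ (c ≡ᵇ t) (is12 ∘ map (at σ)) (choose 2 [ l ])) ⟩
    occ p σ + (if c ≡ᵇ t then countᵇ (is12 ∘ map (at σ)) (choose 2 [ l ]) else 0)
      ≡⟨ cong (λ k → occ p σ + (if c ≡ᵇ t then k else 0)) (count12-positions σ) ⟩
    occ p σ + (if c ≡ᵇ t then count12 σ else 0) ∎
    where
    open ≡-Reasoning
    old′ : ∀ {is} → Ascending 3 1 (suc l) is → isOcc p π is ≡ isOcc p σ is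
    old′ {i₁ ∷ i₂ ∷ i₃ ∷ []} asc = old (ascending⇒Positions asc)
    new′ : ∀ {is} → Ascending 2 1 (suc l) is → isOcc p π (is ∷ʳ suc l) ≡ (c ≡ᵇ t) ∧ is12 (map (at σ) is)
    new′ {i₁ ∷ i₂ ∷ []} (1≤i₁ , _ , i₁<i₂ , i₂<1+l , _) =
      T-⇔→≡ (⇔-sym T-≡ᵇ³ ⇔-∘ new 1≤i₁ i₁<i₂ (≤-pred i₂<1+l))

  occ123-extend : occ p123 π ≡ occ p123 σ + (if c ≡ᵇ 3 then count12 σ else 0)
  occ123-extend = occ-extend p123 3 refl isOcc-123-old isOcc-123-last

  occ132-extend : occ p132 π ≡ occ p132 σ + (if c ≡ᵇ 2 then count12 σ else 0)
  occ132-extend = occ-extend p132 2 refl isOcc-132-old isOcc-132-last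

  count12-extend : count12 π ≡ (if c ≡ᵇ 1 then 0 else if c ≡ᵇ 2 then 1 else count12 σ)
  count12-extend = begin
    count12 π
      ≡⟨ countᵇ-choose-∷ʳ is12 1 (map (punchIn c) σ) c ⟩
    countᵇ is12 (choose 2 (map (punchIn c) σ)) + countᵇ (is12 ∘ (_∷ʳ c)) (choose 1 (map (punchIn c) σ))
      ≡⟨ cong₂ _+_ (countᵇ-choose-map is12 2)
                   (trans (countᵇ-choose-map (is12 ∘ (_∷ʳ c)) 1) (countᵇ-choose-1 _ σ)) ⟩
    countᵇ (is12 ∘ map (punchIn c)) (choose 2 σ) + countᵇ (λ x → (punchIn c x ≡ᵇ 1) ∧ (c ≡ᵇ 2)) σ
      ≡⟨ by-cases c c-range ⟩
    (if c ≡ᵇ 1 then 0 else if c ≡ᵇ 2 then 1 else count12 σ) ∎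
    where
    open ≡-Reasoning
    countᵇ-choose-map : ∀ p k → countᵇ p (choose k (map (punchIn c) σ)) ≡ countᵇ (p ∘ map (punchIn c)) (choose k σ)
    countᵇ-choose-map p k =
      trans (cong (countᵇ p) (choose-map (punchIn c) k σ)) (countᵇ-map p (map (punchIn c)) (choose k σ))
    by-cases : ∀ c → InRange (suc l) c →
               countᵇ (is12 ∘ map (punchIn c)) (choose 2 σ) + countᵇ (λ x → (punchIn c x ≡ᵇ 1) ∧ (c ≡ᵇ 2)) σ
                 ≡ (if c ≡ᵇ 1 then 0 else if c ≡ᵇ 2 then 1 else count12 σ)
    by-cases 1 _ = cong₂ _+_
      (trans (countᵇ-≗ is12-punchIn-1 (choose 2 σ)) (countᵇ-false (choose 2 σ)))
      (trans (countᵇ-≗ (λ x → ∧-zeroʳ (punchIn 1 x ≡ᵇ 1)) σ) (countᵇ-false σ))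
    by-cases 2 (_ , 2≤1+l) = cong₂ _+_
      (trans (countᵇ-≗ is12-punchIn-2 (choose 2 σ)) (countᵇ-false (choose 2 σ)))
      (begin
        countᵇ (λ x → (punchIn 2 x ≡ᵇ 1) ∧ true) σ
          ≡⟨ countᵇ-≗ (λ x → trans (∧-identityʳ _) (punchIn-≡ᵇ (s≤s (s≤s z≤n)) x)) σ ⟩
        countᵇ (_≡ᵇ 1) σ
          ≡⟨ countᵇ-≡ᵇ-unique (unique σ-perm) (∈-IsPerm σ-perm (≤-refl , ≤-pred 2≤1+l)) ⟩
        1 ∎)
    by-cases (suc (suc (suc k))) _ = trans
      (cong₂ _+_ (countᵇ-≗ (is12-punchIn (s≤s (s≤s (s≤s z≤n)))) (choose 2 σ))
                 (trans (countᵇ-≗ (λ x → ∧-zeroʳ (punchIn (3 + k) x ≡ᵇ 1)) σ) (countᵇ-false σ)))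
      (+-identityʳ (count12 σ))

-- `oneBeforeTwo cs` tells whether 1 precedes 2 in `decode cs` (`count12-decode`).
oneBeforeTwoStep : Bool → ℕ → Bool
oneBeforeTwoStep a c = if c ≡ᵇ 1 then false else if c ≡ᵇ 2 then true else a

oneBeforeTwo : List ℕ → Bool
oneBeforeTwo []       = false
oneBeforeTwo (c ∷ cs) = oneBeforeTwoStep (oneBeforeTwo cs) c

-- `occᶜ 3 cs` and `occᶜ 2 cs` count the occurrences of (123, R₃) and (132, R₃) in `decode cs` (`occ-decode`).
occᶜ : ℕ → List ℕ → ℕ
occᶜ t []       = 0
occᶜ t (c ∷ cs) = occᶜ t cs + (if c ≡ᵇ t then toℕ (oneBeforeTwo cs) else 0)

count12-decode : ∀ n {cs} → cs ∈ codes n → count12 (decode cs) ≡ toℕ (oneBeforeTwo cs)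
count12-decode zero    (here refl) = refl
count12-decode (suc n) {[]}     []∈  = contradiction []∈ ([]∉codes {n})
count12-decode (suc n) {c ∷ cs} ccs∈ with c-range , cs∈ ← ∈-codes⁻ {n} ccs∈
  rewrite Extension.count12-extend (IsPerm-decode {n} cs∈) c-range with c ≡ᵇ 1
... | true  = refl
... | false with c ≡ᵇ 2
...   | true  = refl
...   | false = count12-decode n cs∈

occ-decode : ∀ p t → occ p [] ≡ 0 →
  (∀ {n σ c} → IsPerm n σ → InRange (suc n) c →
     occ p (extend σ c) ≡ occ p σ + (if c ≡ᵇ t then count12 σ else 0)) →
  ∀ n {cs} → cs ∈ codes n → occ p (decode cs) ≡ occᶜ t cs
occ-decode p t base step zero    (here refl) = base
occ-decode p t base step (suc n) {[]}     []∈  = contradiction []∈ ([]∉codes {n})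
occ-decode p t base step (suc n) {c ∷ cs} ccs∈ with c-range , cs∈ ← ∈-codes⁻ {n} ccs∈ =
  trans (step (IsPerm-decode {n} cs∈) c-range)
        (cong₂ (λ k m → k + (if c ≡ᵇ t then m else 0)) (occ-decode p t base step n cs∈) (count12-decode n cs∈))

swap23 : ℕ → ℕ
swap23 2 = 3
swap23 3 = 2
swap23 c = c

swapCode : List ℕ → List ℕ
swapCode []       = []
swapCode (c ∷ cs) = (if oneBeforeTwo cs then swap23 c else c) ∷ swapCode cs

oneBeforeTwoStep-swap23 : ∀ c → oneBeforeTwoStep true (swap23 c) ≡ oneBeforeTwoStep true c
oneBeforeTwoStep-swap23 0                   = refl
oneBeforeTwoStep-swap23 1                   = refl
oneBeforeTwoStep-swap23 2                   = refl
oneBeforeTwoStep-swap23 3                   = refl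
oneBeforeTwoStep-swap23 (suc (suc (suc (suc _)))) = refl

oneBeforeTwo-swapCode : ∀ cs → oneBeforeTwo (swapCode cs) ≡ oneBeforeTwo cs
oneBeforeTwo-swapCode []       = refl
oneBeforeTwo-swapCode (c ∷ cs) rewrite oneBeforeTwo-swapCode cs with oneBeforeTwo cs
... | true  = oneBeforeTwoStep-swap23 c
... | false = refl

swap23-involutive : ∀ c → swap23 (swap23 c) ≡ c
swap23-involutive 0                   = refl
swap23-involutive 1                   = refl
swap23-involutive 2                   = refl
swap23-involutive 3                   = refl
swap23-involutive (suc (suc (suc (suc _)))) = refl

swapCode-involutive : ∀ cs → swapCode (swapCode cs) ≡ cs
swapCode-involutive []       = refl
swapCode-involutive (c ∷ cs) rewrite oneBeforeTwo-swapCode cs | swapCode-involutive cs with oneBeforeTwo cs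
... | true  = cong (_∷ cs) (swap23-involutive c)
... | false = refl

swap23-≡ᵇ2 : ∀ c → (swap23 c ≡ᵇ 2) ≡ (c ≡ᵇ 3)
swap23-≡ᵇ2 0                   = refl
swap23-≡ᵇ2 1                   = refl
swap23-≡ᵇ2 2                   = refl
swap23-≡ᵇ2 3                   = refl
swap23-≡ᵇ2 (suc (suc (suc (suc _)))) = refl

occᶜ-swapCode : ∀ cs → occᶜ 2 (swapCode cs) ≡ occᶜ 3 cs
occᶜ-swapCode []       = refl
occᶜ-swapCode (c ∷ cs) rewrite occᶜ-swapCode cs | oneBeforeTwo-swapCode cs with oneBeforeTwo cs
... | true  rewrite swap23-≡ᵇ2 c = refl
... | false with c ≡ᵇ 2 | c ≡ᵇ 3
...   | true  | true  = refl
...   | true  | false = refl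
...   | false | true  = refl
...   | false | false = refl

oneBeforeTwo⇒2≤ : ∀ n {cs} → cs ∈ codes n → T (oneBeforeTwo cs) → 2 ≤ n
oneBeforeTwo⇒2≤ zero    (here refl) ()
oneBeforeTwo⇒2≤ (suc n) {[]}                      []∈ _ = contradiction []∈ ([]∉codes {n})
oneBeforeTwo⇒2≤ (suc n) {1 ∷ cs}                  _   ()
oneBeforeTwo⇒2≤ (suc n) {2 ∷ cs}                  ccs∈ _ = proj₂ (proj₁ (∈-codes⁻ {n} ccs∈))
oneBeforeTwo⇒2≤ (suc n) {0 ∷ cs}                  ccs∈ t = m≤n⇒m≤1+n (oneBeforeTwo⇒2≤ n (proj₂ (∈-codes⁻ {n} ccs∈)) t)
oneBeforeTwo⇒2≤ (suc n) {suc (suc (suc _)) ∷ cs} ccs∈ t = m≤n⇒m≤1+n (oneBeforeTwo⇒2≤ n (proj₂ (∈-codes⁻ {n} ccs∈)) t)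

swap23-InRange : ∀ {n c} → 2 ≤ n → InRange (suc n) c → InRange (suc n) (swap23 c)
swap23-InRange {c = 2} 2≤n _ = s≤s z≤n , s≤s 2≤n
swap23-InRange {c = 3} 2≤n _ = s≤s z≤n , m≤n⇒m≤1+n 2≤n
swap23-InRange {c = 0}                   _ c-range = c-range
swap23-InRange {c = 1}                   _ c-range = c-range
swap23-InRange {c = suc (suc (suc (suc _)))} _ c-range = c-range

swapCode-∈ : ∀ n {cs} → cs ∈ codes n → swapCode cs ∈ codes n
swapCode-∈ zero    (here refl) = here refl
swapCode-∈ (suc n) {[]}     []∈  = contradiction []∈ ([]∉codes {n})
swapCode-∈ (suc n) {c ∷ cs} ccs∈ with c-range , cs∈ ← ∈-codes⁻ {n} ccs∈ =
  ∈-codes⁺ (head-range (oneBeforeTwo cs) refl) (swapCode-∈ n cs∈)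
  where
  head-range : ∀ b → oneBeforeTwo cs ≡ b → InRange (suc n) (if b then swap23 c else c)
  head-range true  eq = swap23-InRange (oneBeforeTwo⇒2≤ n cs∈ (subst T (sym eq) _)) c-range
  head-range false _  = c-range

swapCode-↭ : ∀ n → map swapCode (codes n) ↭ codes n
swapCode-↭ n =
  Unique-⊆⊇⇒↭ (Unique.map⁺ {f = swapCode} swapCode-injective (codes-unique n)) (codes-unique n) to from
  where
  swapCode-injective : ∀ {cs cs′} → swapCode cs ≡ swapCode cs′ → cs ≡ cs′
  swapCode-injective {cs} {cs′} eq =
    trans (sym (swapCode-involutive cs)) (trans (cong swapCode eq) (swapCode-involutive cs′))
  to : ∀ {cs} → cs ∈ map swapCode (codes n) → cs ∈ codes n
  to cs∈ with _ , cs′∈ , refl ← ∈-map⁻ swapCode cs∈ = swapCode-∈ n cs′∈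
  from : ∀ {cs} → cs ∈ codes n → cs ∈ map swapCode (codes n)
  from {cs} cs∈ = subst (_∈ map swapCode (codes n)) (swapCode-involutive cs) (∈-map⁺ swapCode (swapCode-∈ n cs∈))

theorem3p3 : mesh (1 ∷ 2 ∷ 3 ∷ []) R₃ ∼d mesh (1 ∷ 3 ∷ 2 ∷ []) R₃
theorem3p3 n ℓ = begin
  count p123 n ℓ
    ≡⟨ count≡countᵇ-codes p123 (occᶜ 3) (occ-decode p123 3 refl Extension.occ123-extend) n ℓ ⟩
  countᵇ (λ cs → occᶜ 3 cs ≡ᵇ ℓ) (codes n)
    ≡⟨ countᵇ-≗ (λ cs → cong (_≡ᵇ ℓ) (occᶜ-swapCode cs)) (codes n) ⟨
  countᵇ (λ cs → occᶜ 2 (swapCode cs) ≡ᵇ ℓ) (codes n)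
    ≡⟨ countᵇ-map (λ cs → occᶜ 2 cs ≡ᵇ ℓ) swapCode (codes n) ⟨
  countᵇ (λ cs → occᶜ 2 cs ≡ᵇ ℓ) (map swapCode (codes n))
    ≡⟨ countᵇ-↭ (λ cs → occᶜ 2 cs ≡ᵇ ℓ) (swapCode-↭ n) ⟩
  countᵇ (λ cs → occᶜ 2 cs ≡ᵇ ℓ) (codes n)
    ≡⟨ count≡countᵇ-codes p132 (occᶜ 2) (occ-decode p132 2 refl Extension.occ132-extend) n ℓ ⟨
  count p132 n ℓ ∎
  where open ≡-Reasoning
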